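{- Let $p_1<p_2<p_3$ be odd primes with $p_2\equiv 1 \pmod{p_1}$ and $p_3\equiv 1\pmod{p_1p_2}$, let $q_2=(p_2-1)/p_1$, and let $0\le i_1\le p_1-2$, $0\le i_2\le q_2-1$, $0\le i_3\le p_1-1$ be integers. Let $u=i_1(p_2-1)+i_2p_1+i_3$. Then $$\Phi_{p_1}\,\mathcal{T}_{u+1}\Phi_{p_1p_2}=\sum_{a=0}^{i_1}x^{ap_2}+x^{i_1p_2}x^{i_2p_1}\sum_{k=1}^{p_1-1-i_1}x^k+x^{i_1p_2}x^{i_2p_1}\,\mathcal{T}_{i_3-i_1+1}(-x)\sum_{k=0}^{p_1-1}x^k.$$
   Context: $\Phi_n$ denotes the $n$-th cyclotomic polynomial; $\Phi_{p_1}=1+x+\cdots+x^{p_1-1}$. For a polynomial $h$ and integer $s\ge1$, $\mathcal{T}_s(h)=\mathrm{rem}(h,x^s)$ is the truncation of $h$ to its terms of degree $<s$; by convention $\mathcal{T}_s(h)=0$ for $s\le 0$. In particular $\mathcal{T}_s(-x)=-x$ if $s\ge 2$ and $0$ if $s\le 1$. -}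

module Defs where

open import Data.Nat as ℕ using (ℕ; zero; suc; _∸_)
open import Data.Nat.Divisibility using (_∣?_)
open import Data.Nat.Induction using (<-rec)
open import Data.Integer as ℤ using (ℤ; +_; _+_; _*_; -_)
open import Data.Fin using (Fin; toℕ)
open import Data.Fin.Properties using (toℕ<n)
open import Data.List using (List; []; _∷_; map; foldr; upTo; zipWith; allFin)
open import Data.Bool using (if_then_else_)
open import Relation.Nullary.Decidable using (does)
open import Relation.Binary.PropositionalEquality using (_≡_)

-- Formal power series (in particular polynomials) over ℤ, given by their
-- coefficient sequence: f n is the coefficient of x^n.
Series : Set
Series = ℕ → ℤ

0S 1S : Series
0S _ = + 0
1S zero = + 1
1S (suc _) = + 0

X^ : ℕ → Series
X^ k m = if does (m ℕ.≟ k) then + 1 else + 0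

infixl 6 _⊕_
infixl 7 _⊛_

_⊕_ : Series → Series → Series
(f ⊕ g) m = f m + g m

⊝_ : Series → Series
(⊝ f) m = - f m

sumℤ : List ℤ → ℤ
sumℤ = foldr _+_ (+ 0)

_⊛_ : Series → Series → Series
(f ⊛ g) m = sumℤ (map (λ k → f k * g (m ∸ k)) (upTo (suc m)))

ΣS : List ℕ → (ℕ → Series) → Series
ΣS is F = foldr (λ i acc → F i ⊕ acc) 0S is

ΠS : {A : Set} → List A → (A → Series) → Series
ΠS is F = foldr (λ i acc → F i ⊛ acc) 1S is

-- Inverse of a power series whose constant term is a unit (+1 or -1) of ℤ:
-- g 0 = f 0, g (n+1) = - f 0 * Σ_{k=1}^{n+1} f k * g (n+1-k).
-- invRev f n = [g n, g (n-1), ..., g 0]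
invRev : Series → ℕ → List ℤ
invRev f zero = f 0 ∷ []
invRev f (suc n) =
  let prev = invRev f n
  in (- (f 0 * sumℤ (zipWith _*_ (map (λ k → f (suc k)) (upTo (suc n))) prev))) ∷ prev

headOr0 : List ℤ → ℤ
headOr0 [] = + 0
headOr0 (z ∷ _) = z

inv : Series → Series
inv f n = headOr0 (invRev f n)

X^-1 : ℕ → Series
X^-1 n = X^ n ⊕ ⊝ 1S

-- Cyclotomic polynomials, defined by  x^n - 1 = ∏_{d ∣ n} Φ_d, i.e.
-- Φ_n = (x^n - 1) / ∏_{d ∣ n, d < n} Φ_d   (for n ≥ 1).
Φ : ℕ → Series
Φ = <-rec (λ _ → Series) step
  where
  step : (n : ℕ) → (∀ {m} → m ℕ.< n → Series) → Series
  step n rec = X^-1 n ⊛ inv (ΠS (allFin n) (λ i →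
                 if does (toℕ i ∣? n) then rec (toℕ<n i) else 1S))

-- Truncation 𝒯_s(h) = rem(h, x^s): terms of degree < s (0 when s ≤ 0).
𝒯 : ℤ → Series → Series
𝒯 s h m = if does (+ m ℤ.<? s) then h m else + 0

infix 4 _≈S_
_≈S_ : Series → Series → Set
f ≈S g = ∀ m → f m ≡ g m

{-# OPTIONS --safe #-}
module Submission where

-- Write p = p₁ and P = p₂ = 1 + q p.  Unfolding the recursive definition of Φ gives
-- Φ_p = 1 + x + ⋯ + x^(p-1) and Φ_(pP) (x - 1) Φ_p Φ_P = x^(pP) - 1, hence Φ_p Φ_(pP) = Φ_p(x^P).
-- Comparing coefficients in (x^p - 1) Φ_(pP) = (x - 1) Φ_p(x^P) shows that for 0 < r < p the
-- coefficient of x^(Np + r) in Φ_(pP) is [r q ≤ N] - [(r - 1) q ≤ N], and that of x^(Np) is 1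
-- as long as N ≤ (p - 1) q.  Passing from u - 1 to u adds (coefficient of x^u) · x^u Φ_p to the
-- left-hand side.  Writing u = (i₁ q + i₂) p + i₃, within a row k = i₁ q + i₂ that coefficient
-- is -1 exactly at i₃ = i₁ + 1, which subtracts a block x^u Φ_p; at the start of the next row it
-- is 1, and the block added there cancels against the subtracted one up to moving the run of
-- single powers x^(kp + i₁ + 1), … up by p.  After q rows the first of them splits off as
-- x^((i₁ + 1) P).

open import Defs
open import Data.Nat as ℕ using (ℕ; zero; suc; _+_; _*_; _∸_; _≤_; _<_; z≤n; s≤s; NonZero)
import Data.Nat.Properties as ℕ
open import Data.Integer as ℤ using (ℤ; +_; -_; _⊖_) renaming (_+_ to _+ℤ_; _-_ to _-ℤ_; _*_ to _*ℤ_)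
import Data.Integer.Properties as ℤ
open import Data.Integer.Tactic.RingSolver using (solve-∀)
import Data.Nat.Tactic.RingSolver as ℕS
open import Data.List using (List; []; _∷_; map; upTo; applyUpTo; zipWith; allFin)
open import Data.List.Membership.Propositional using (_∈_)
open import Data.List.Membership.Propositional.Properties using (∈-allFin; ∈-upTo⁺; ∈-upTo⁻)
open import Data.List.Relation.Unary.Any using (here; there)
open import Data.List.Relation.Unary.All as All using ([]; _∷_)
open import Data.List.Relation.Unary.Unique.Propositional using (Unique; []; _∷_)
open import Data.List.Relation.Unary.Unique.Propositional.Properties using (allFin⁺; upTo⁺)
open import Data.Fin using (toℕ; fromℕ<)
open import Data.Fin.Properties using (toℕ<n; toℕ-fromℕ<; toℕ-injective)
open import Data.Nat.Divisibility using (_∣_; _∣?_; divides; 1∣_; m∣m*n; n∣m*n; *-cancelˡ-∣; 0∣⇒≡0)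
open import Data.Nat.Coprimality using (Coprime; coprime-divisor)
open import Data.Nat.Primality using (Prime; prime⇒irreducible; prime⇒nonZero; prime⇒nonTrivial)
open import Data.Sum using (_⊎_; inj₁; inj₂; [_,_]′)
open import Data.Nat.DivMod using (_%_; [m+kn]%n≡m%n; m<n⇒m%n≡m)
open import Data.List.Properties using (map-applyUpTo; map-upTo; map-cong)
open import Data.Bool using (true; false; if_then_else_)
open import Data.Nat.Induction using (<-wellFounded)
open import Induction.WellFounded using (Acc; acc; module Some)
open import Relation.Nullary using (Dec; yes; no; ¬_; contradiction)
open import Relation.Nullary.Decidable using (does; dec-true; dec-false)
open import Relation.Binary using (Setoid)
import Relation.Binary.Reasoning.Setoid
open import Relation.Binary.PropositionalEquality
open import Relation.Binary.Definitions using (tri<; tri≈; tri>)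
open import Function using (_∘_; id)
open import Level using (0ℓ)
open import Data.Product using (_×_; _,_; proj₁; proj₂)

if-yes : ∀ {a b} {A : Set a} {B : Set b} (a? : Dec A) {x y : B} → A → (if does a? then x else y) ≡ x
if-yes a? a rewrite dec-true a? a = refl

if-no : ∀ {a b} {A : Set a} {B : Set b} (a? : Dec A) {x y : B} → ¬ A → (if does a? then x else y) ≡ y
if-no a? ¬a rewrite dec-false a? ¬a = refl

if-same : ∀ {a b} {A : Set a} {B : Set b} (a? : Dec A) {x : B} → (if does a? then x else x) ≡ x
if-same a? with does a?
... | true = refl
... | false = refl

𝟙 : ∀ {a} {A : Set a} → Dec A → ℤ
𝟙 a? = if does a? then + 1 else + 0

𝟙-yes : ∀ {a} {A : Set a} (a? : Dec A) → A → 𝟙 a? ≡ + 1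
𝟙-yes a? = if-yes a?

𝟙-no : ∀ {a} {A : Set a} (a? : Dec A) → ¬ A → 𝟙 a? ≡ + 0
𝟙-no a? = if-no a?

𝟙-≤-zero : ∀ c → 𝟙 (c ℕ.≤? 0) ≡ 𝟙 (0 ℕ.≟ c)
𝟙-≤-zero zero = refl
𝟙-≤-zero (suc c) = refl

𝟙-≤-suc : ∀ c N → 𝟙 (c ℕ.≤? suc N) ≡ 𝟙 (c ℕ.≤? N) +ℤ 𝟙 (suc N ℕ.≟ c)
𝟙-≤-suc c N with c ℕ.≤? N | suc N ℕ.≟ c
... | yes c≤N | _ = trans (𝟙-yes (c ℕ.≤? suc N) (ℕ.m≤n⇒m≤1+n c≤N)) (sym (cong₂ _+ℤ_
      (𝟙-yes (c ℕ.≤? N) c≤N) (𝟙-no (suc N ℕ.≟ c) (λ { refl → ℕ.<-irrefl refl c≤N }))))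
... | no c≰N | yes refl = trans (𝟙-yes (c ℕ.≤? c) ℕ.≤-refl) (sym (cong₂ _+ℤ_
      (𝟙-no (c ℕ.≤? N) c≰N) (𝟙-yes (c ℕ.≟ c) refl)))
... | no c≰N | no N+1≢c = trans (𝟙-no (c ℕ.≤? suc N) c≰N+1) (sym (cong₂ _+ℤ_
      (𝟙-no (c ℕ.≤? N) c≰N) (𝟙-no (suc N ℕ.≟ c) N+1≢c)))
  where
  c≰N+1 : ¬ c ≤ suc N
  c≰N+1 c≤N+1 = [ c≰N ∘ ℕ.m<1+n⇒m≤n , N+1≢c ∘ sym ]′ (ℕ.m≤n⇒m<n∨m≡n c≤N+1)

𝟙-≤-complement : ∀ m n → 𝟙 (m ℕ.≤? n) ≡ + 1 -ℤ 𝟙 (n ℕ.<? m)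
𝟙-≤-complement m n with m ℕ.≤? n
... | yes m≤n = trans (𝟙-yes (m ℕ.≤? n) m≤n) (sym (cong (+ 1 -ℤ_) (𝟙-no (n ℕ.<? m) (ℕ.≤⇒≯ m≤n))))
... | no m≰n = trans (𝟙-no (m ℕ.≤? n) m≰n) (sym (cong (+ 1 -ℤ_) (𝟙-yes (n ℕ.<? m) (ℕ.≰⇒> m≰n))))

𝟙-≤-scaled : ∀ q c i₁ {i₂} → i₂ < q → 𝟙 (c * q ℕ.≤? i₁ * q + i₂) ≡ 𝟙 (c ℕ.≤? i₁)
𝟙-≤-scaled q c i₁ {i₂} i₂<q with c ℕ.≤? i₁
... | yes c≤i₁ = trans (𝟙-yes (c * q ℕ.≤? i₁ * q + i₂) (ℕ.≤-trans (ℕ.*-monoˡ-≤ q c≤i₁) (ℕ.m≤m+n (i₁ * q) i₂)))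
                   (sym (𝟙-yes (c ℕ.≤? i₁) c≤i₁))
... | no c≰i₁ = trans (𝟙-no (c * q ℕ.≤? i₁ * q + i₂) (ℕ.<⇒≱ below)) (sym (𝟙-no (c ℕ.≤? i₁) c≰i₁))
  where
  below : i₁ * q + i₂ < c * q
  below = ℕ.<-≤-trans (ℕ.+-monoʳ-< (i₁ * q) i₂<q)
            (subst (_≤ c * q) (ℕ.+-comm q (i₁ * q)) (ℕ.*-monoˡ-≤ q (ℕ.≰⇒> c≰i₁)))

𝟙-threshold : ∀ i j → 𝟙 (+ 1 ℤ.<? (+ j -ℤ + i) +ℤ + 1) ≡ 𝟙 (i ℕ.<? j)
𝟙-threshold i j = trans (cong (λ s → 𝟙 (+ 1 ℤ.<? s)) ⊖-form) compare
  where
  ⊖-form : (+ j -ℤ + i) +ℤ + 1 ≡ suc j ⊖ i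
  ⊖-form = trans (regroup (+ j) (+ i)) (ℤ.m-n≡m⊖n (suc j) i)
    where
    regroup : ∀ a b → a -ℤ b +ℤ + 1 ≡ (+ 1 +ℤ a) -ℤ b
    regroup = solve-∀
  1+n⊖n : ∀ n → suc n ⊖ n ≡ + 1
  1+n⊖n zero = refl
  1+n⊖n (suc n) = trans (ℤ.[1+m]⊖[1+n]≡m⊖n (suc n) n) (1+n⊖n n)
  compare : 𝟙 (+ 1 ℤ.<? suc j ⊖ i) ≡ 𝟙 (i ℕ.<? j)
  compare with i ℕ.<? j
  ... | yes i<j = trans (𝟙-yes (+ 1 ℤ.<? suc j ⊖ i) (subst (ℤ._< suc j ⊖ i) (1+n⊖n j) (ℤ.⊖-monoʳ->-< (suc j) i<j)))
                    (sym (𝟙-yes (i ℕ.<? j) i<j))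
  ... | no i≮j = trans (𝟙-no (+ 1 ℤ.<? suc j ⊖ i) (ℤ.≤⇒≯ (subst (suc j ⊖ i ℤ.≤_) (1+n⊖n j)
                                                              (ℤ.⊖-monoʳ-≥-≤ (suc j) (ℕ.≮⇒≥ i≮j)))))
                   (sym (𝟙-no (i ℕ.<? j) i≮j))

euclid-unique : ∀ {p M N r s} .{{_ : NonZero p}} → r < p → s < p → M * p + r ≡ N * p + s → M ≡ N × r ≡ s
euclid-unique {p} {M} {N} {r} {s} r<p s<p eq =
  ℕ.*-cancelʳ-≡ M N p (ℕ.+-cancelʳ-≡ r (M * p) (N * p) (trans eq (cong (λ x → N * p + x) (sym r≡s)))) , r≡s
  where
  open ≡-Reasoning
  r≡s : r ≡ s
  r≡s = begin
    r                    ≡⟨ m<n⇒m%n≡m r<p ⟨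
    r % p                ≡⟨ [m+kn]%n≡m%n r M p ⟨
    (r + M * p) % p      ≡⟨ cong (_% p) (trans (ℕ.+-comm r (M * p)) (trans eq (ℕ.+-comm (N * p) s))) ⟩
    (s + N * p) % p      ≡⟨ [m+kn]%n≡m%n s N p ⟩
    s % p                ≡⟨ m<n⇒m%n≡m s<p ⟩
    s                    ∎

prime>1 : ∀ {p} → Prime p → 1 < p
prime>1 {p} p-prime = ℕ.nonTrivial⇒n>1 p {{prime⇒nonTrivial p-prime}}

prime∤⇒coprime : ∀ {p d} → Prime p → ¬ p ∣ d → Coprime d p
prime∤⇒coprime p-prime p∤d (c∣d , c∣p) with prime⇒irreducible p-prime c∣p
... | inj₁ c≡1 = c≡1
... | inj₂ refl = contradiction c∣d p∤d

∣-prime*prime : ∀ {p q d} → Prime p → Prime q → d ∣ p * q → d ≡ 1 ⊎ d ≡ p ⊎ d ≡ q ⊎ d ≡ p * q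
∣-prime*prime {p} {q} {d} p-prime q-prime d∣pq with p ∣? d
... | yes (divides e refl) with prime⇒irreducible q-prime
                                  (*-cancelˡ-∣ p {{prime⇒nonZero p-prime}} (subst (_∣ p * q) (ℕ.*-comm e p) d∣pq))
...   | inj₁ refl = inj₂ (inj₁ (ℕ.*-identityˡ p))
...   | inj₂ refl = inj₂ (inj₂ (inj₂ (ℕ.*-comm q p)))
∣-prime*prime p-prime q-prime d∣pq | no p∤d with prime⇒irreducible q-prime (coprime-divisor (prime∤⇒coprime p-prime p∤d) d∣pq)
...   | inj₁ d≡1 = inj₁ d≡1
...   | inj₂ d≡q = inj₂ (inj₂ (inj₁ d≡q))

-- The ring of power series

≈S-setoid : Setoid 0ℓ 0ℓ
≈S-setoid = record
  { Carrier = Series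
  ; _≈_ = _≈S_
  ; isEquivalence = record
    { refl = λ _ → refl
    ; sym = λ f≈g m → sym (f≈g m)
    ; trans = λ f≈g g≈h m → trans (f≈g m) (g≈h m)
    }
  }

open Setoid ≈S-setoid public using () renaming (refl to ≈S-refl; reflexive to ≈S-reflexive; sym to ≈S-sym; trans to ≈S-trans)
module ≈-Reasoning = Relation.Binary.Reasoning.Setoid ≈S-setoid

tail : Series → Series
tail f m = f (suc m)

infixr 8 _•_
_•_ : ℤ → Series → Series
(c • f) m = c *ℤ f m

⊛-suc : ∀ f g m → (f ⊛ g) (suc m) ≡ f 0 *ℤ g (suc m) +ℤ (tail f ⊛ g) m
⊛-suc f g m = cong (f 0 *ℤ g (suc m) +ℤ_) (cong sumℤ (begin
  map term (applyUpTo suc (suc m))       ≡⟨ map-applyUpTo suc term (suc m) ⟩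
  applyUpTo (term ∘ suc) (suc m)         ≡⟨ map-upTo (term ∘ suc) (suc m) ⟨
  map (term ∘ suc) (upTo (suc m))        ∎))
  where
  open ≡-Reasoning
  term : ℕ → ℤ
  term k = f k *ℤ g (suc m ∸ k)

⊛-congˡ : ∀ {f f′} g → f ≈S f′ → f ⊛ g ≈S f′ ⊛ g
⊛-congˡ g f≈f′ zero = cong (λ a → a *ℤ g 0 +ℤ + 0) (f≈f′ 0)
⊛-congˡ {f} {f′} g f≈f′ (suc m) = begin
  (f ⊛ g) (suc m)                         ≡⟨ ⊛-suc f g m ⟩
  f 0 *ℤ g (suc m) +ℤ (tail f ⊛ g) m      ≡⟨ cong₂ (λ a b → a *ℤ g (suc m) +ℤ b)
                                               (f≈f′ 0) (⊛-congˡ g (f≈f′ ∘ suc) m) ⟩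
  f′ 0 *ℤ g (suc m) +ℤ (tail f′ ⊛ g) m    ≡⟨ ⊛-suc f′ g m ⟨
  (f′ ⊛ g) (suc m)                        ∎
  where open ≡-Reasoning

⊛-congʳ : ∀ f {g g′} → g ≈S g′ → f ⊛ g ≈S f ⊛ g′
⊛-congʳ f g≈g′ zero = cong (λ a → f 0 *ℤ a +ℤ + 0) (g≈g′ 0)
⊛-congʳ f {g} {g′} g≈g′ (suc m) = begin
  (f ⊛ g) (suc m)                         ≡⟨ ⊛-suc f g m ⟩
  f 0 *ℤ g (suc m) +ℤ (tail f ⊛ g) m      ≡⟨ cong₂ (λ a b → f 0 *ℤ a +ℤ b)
                                               (g≈g′ (suc m)) (⊛-congʳ (tail f) g≈g′ m) ⟩
  f 0 *ℤ g′ (suc m) +ℤ (tail f ⊛ g′) m    ≡⟨ ⊛-suc f g′ m ⟨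
  (f ⊛ g′) (suc m)                        ∎
  where open ≡-Reasoning

⊛-cong : ∀ {f f′ g g′} → f ≈S f′ → g ≈S g′ → f ⊛ g ≈S f′ ⊛ g′
⊛-cong {f′ = f′} {g = g} f≈f′ g≈g′ m = trans (⊛-congˡ g f≈f′ m) (⊛-congʳ f′ g≈g′ m)

⊕-cong : ∀ {f f′ g g′} → f ≈S f′ → g ≈S g′ → f ⊕ g ≈S f′ ⊕ g′
⊕-cong f≈f′ g≈g′ m = cong₂ _+ℤ_ (f≈f′ m) (g≈g′ m)

•-congˡ : ∀ {c c′} f → c ≡ c′ → c • f ≈S c′ • f
•-congˡ f refl m = refl

•-congʳ : ∀ c {f f′} → f ≈S f′ → c • f ≈S c • f′
•-congʳ c f≈f′ m = cong (c *ℤ_) (f≈f′ m)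

-- The second-order unfolding lets both sides of (f ⊛ g) (2 + k) meet at (tail f ⊛ tail g) k.
⊛-comm : ∀ f g → f ⊛ g ≈S g ⊛ f
⊛-comm f g zero = cong (_+ℤ + 0) (ℤ.*-comm (f 0) (g 0))
⊛-comm f g (suc zero) = begin
  (f ⊛ g) 1                              ≡⟨ ⊛-suc f g 0 ⟩
  f 0 *ℤ g 1 +ℤ (tail f ⊛ g) 0           ≡⟨ cong (f 0 *ℤ g 1 +ℤ_) (⊛-comm (tail f) g 0) ⟩
  f 0 *ℤ g 1 +ℤ (g 0 *ℤ f 1 +ℤ + 0)      ≡⟨ swap (f 0 *ℤ g 1) (g 0 *ℤ f 1) ⟩
  g 0 *ℤ f 1 +ℤ (f 0 *ℤ g 1 +ℤ + 0)      ≡⟨ cong (g 0 *ℤ f 1 +ℤ_) (⊛-comm f (tail g) 0) ⟩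
  g 0 *ℤ f 1 +ℤ (tail g ⊛ f) 0           ≡⟨ ⊛-suc g f 0 ⟨
  (g ⊛ f) 1                              ∎
  where
  open ≡-Reasoning
  swap : ∀ a b → a +ℤ (b +ℤ + 0) ≡ b +ℤ (a +ℤ + 0)
  swap = solve-∀
⊛-comm f g (suc (suc k)) = begin
  (f ⊛ g) (2 + k)                                            ≡⟨ ⊛-suc f g (suc k) ⟩
  f 0 *ℤ g (2 + k) +ℤ (tail f ⊛ g) (suc k)                   ≡⟨ cong (f 0 *ℤ g (2 + k) +ℤ_) (trans
                                                                  (⊛-comm (tail f) g (suc k)) (⊛-suc g (tail f) k)) ⟩
  f 0 *ℤ g (2 + k) +ℤ (g 0 *ℤ f (2 + k) +ℤ (tail g ⊛ tail f) k) ≡⟨ cong (λ a → f 0 *ℤ g (2 + k) +ℤ (g 0 *ℤ f (2 + k) +ℤ a))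
                                                                  (⊛-comm (tail g) (tail f) k) ⟩
  f 0 *ℤ g (2 + k) +ℤ (g 0 *ℤ f (2 + k) +ℤ (tail f ⊛ tail g) k) ≡⟨ swap (f 0 *ℤ g (2 + k)) (g 0 *ℤ f (2 + k)) _ ⟩
  g 0 *ℤ f (2 + k) +ℤ (f 0 *ℤ g (2 + k) +ℤ (tail f ⊛ tail g) k) ≡⟨ cong (g 0 *ℤ f (2 + k) +ℤ_) (sym (trans
                                                                  (⊛-comm (tail g) f (suc k)) (⊛-suc f (tail g) k))) ⟩
  g 0 *ℤ f (2 + k) +ℤ (tail g ⊛ f) (suc k)                   ≡⟨ ⊛-suc g f (suc k) ⟨
  (g ⊛ f) (2 + k)                                            ∎
  where
  open ≡-Reasoning
  swap : ∀ a b c → a +ℤ (b +ℤ c) ≡ b +ℤ (a +ℤ c)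
  swap = solve-∀

⊛-distribʳ : ∀ f g h → (f ⊕ g) ⊛ h ≈S f ⊛ h ⊕ g ⊛ h
⊛-distribʳ f g h zero = distrib (f 0) (g 0) (h 0) (+ 0) (+ 0)
  where
  distrib : ∀ a b c x y → (a +ℤ b) *ℤ c +ℤ (x +ℤ y) ≡ (a *ℤ c +ℤ x) +ℤ (b *ℤ c +ℤ y)
  distrib = solve-∀
⊛-distribʳ f g h (suc m) = begin
  ((f ⊕ g) ⊛ h) (suc m)                                      ≡⟨ ⊛-suc (f ⊕ g) h m ⟩
  (f 0 +ℤ g 0) *ℤ h (suc m) +ℤ ((tail f ⊕ tail g) ⊛ h) m     ≡⟨ cong ((f 0 +ℤ g 0) *ℤ h (suc m) +ℤ_)
                                                                  (⊛-distribʳ (tail f) (tail g) h m) ⟩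
  (f 0 +ℤ g 0) *ℤ h (suc m) +ℤ ((tail f ⊛ h) m +ℤ (tail g ⊛ h) m)
                                                             ≡⟨ distrib (f 0) (g 0) (h (suc m)) _ _ ⟩
  (f 0 *ℤ h (suc m) +ℤ (tail f ⊛ h) m) +ℤ (g 0 *ℤ h (suc m) +ℤ (tail g ⊛ h) m)
                                                             ≡⟨ cong₂ _+ℤ_ (⊛-suc f h m) (⊛-suc g h m) ⟨
  (f ⊛ h ⊕ g ⊛ h) (suc m)                                    ∎
  where
  open ≡-Reasoning
  distrib : ∀ a b c x y → (a +ℤ b) *ℤ c +ℤ (x +ℤ y) ≡ (a *ℤ c +ℤ x) +ℤ (b *ℤ c +ℤ y)
  distrib = solve-∀

⊛-distribˡ : ∀ f g h → f ⊛ (g ⊕ h) ≈S f ⊛ g ⊕ f ⊛ h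
⊛-distribˡ f g h m = begin
  (f ⊛ (g ⊕ h)) m        ≡⟨ ⊛-comm f (g ⊕ h) m ⟩
  ((g ⊕ h) ⊛ f) m        ≡⟨ ⊛-distribʳ g h f m ⟩
  (g ⊛ f ⊕ h ⊛ f) m      ≡⟨ cong₂ _+ℤ_ (⊛-comm g f m) (⊛-comm h f m) ⟩
  (f ⊛ g ⊕ f ⊛ h) m      ∎
  where open ≡-Reasoning

•-⊛-assoc : ∀ c f g → (c • f) ⊛ g ≈S c • (f ⊛ g)
•-⊛-assoc c f g zero = assoc c (f 0) (g 0)
  where
  assoc : ∀ c a b → c *ℤ a *ℤ b +ℤ + 0 ≡ c *ℤ (a *ℤ b +ℤ + 0)
  assoc = solve-∀
•-⊛-assoc c f g (suc m) = begin
  ((c • f) ⊛ g) (suc m)                                 ≡⟨ ⊛-suc (c • f) g m ⟩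
  c *ℤ f 0 *ℤ g (suc m) +ℤ ((c • tail f) ⊛ g) m         ≡⟨ cong (c *ℤ f 0 *ℤ g (suc m) +ℤ_) (•-⊛-assoc c (tail f) g m) ⟩
  c *ℤ f 0 *ℤ g (suc m) +ℤ c *ℤ (tail f ⊛ g) m          ≡⟨ assoc c (f 0) (g (suc m)) _ ⟩
  c *ℤ (f 0 *ℤ g (suc m) +ℤ (tail f ⊛ g) m)             ≡⟨ cong (c *ℤ_) (⊛-suc f g m) ⟨
  (c • (f ⊛ g)) (suc m)                                 ∎
  where
  open ≡-Reasoning
  assoc : ∀ c a b x → c *ℤ a *ℤ b +ℤ c *ℤ x ≡ c *ℤ (a *ℤ b +ℤ x)
  assoc = solve-∀

⊛-•-comm : ∀ c f g → f ⊛ (c • g) ≈S c • (f ⊛ g)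
⊛-•-comm c f g m = trans (⊛-comm f (c • g) m) (trans (•-⊛-assoc c g f m) (cong (c *ℤ_) (⊛-comm g f m)))

⊛-assoc : ∀ f g h → (f ⊛ g) ⊛ h ≈S f ⊛ (g ⊛ h)
⊛-assoc f g h zero = assoc (f 0) (g 0) (h 0)
  where
  assoc : ∀ a b c → (a *ℤ b +ℤ + 0) *ℤ c +ℤ + 0 ≡ a *ℤ (b *ℤ c +ℤ + 0) +ℤ + 0
  assoc = solve-∀
⊛-assoc f g h (suc m) = begin
  ((f ⊛ g) ⊛ h) (suc m)                                          ≡⟨ ⊛-suc (f ⊛ g) h m ⟩
  (f ⊛ g) 0 *ℤ h (suc m) +ℤ (tail (f ⊛ g) ⊛ h) m                 ≡⟨ cong ((f ⊛ g) 0 *ℤ h (suc m) +ℤ_) tail-step ⟩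
  (f ⊛ g) 0 *ℤ h (suc m) +ℤ (f 0 *ℤ (tail g ⊛ h) m +ℤ (tail f ⊛ (g ⊛ h)) m)
                                                                 ≡⟨ assoc (f 0) (g 0) (h (suc m)) _ _ ⟩
  f 0 *ℤ (g 0 *ℤ h (suc m) +ℤ (tail g ⊛ h) m) +ℤ (tail f ⊛ (g ⊛ h)) m ≡⟨ cong (λ a → f 0 *ℤ a +ℤ (tail f ⊛ (g ⊛ h)) m) (⊛-suc g h m) ⟨
  f 0 *ℤ (g ⊛ h) (suc m) +ℤ (tail f ⊛ (g ⊛ h)) m                 ≡⟨ ⊛-suc f (g ⊛ h) m ⟨
  (f ⊛ (g ⊛ h)) (suc m)                                          ∎
  where
  open ≡-Reasoning
  tail-step : (tail (f ⊛ g) ⊛ h) m ≡ f 0 *ℤ (tail g ⊛ h) m +ℤ (tail f ⊛ (g ⊛ h)) m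
  tail-step = trans (⊛-congˡ h (⊛-suc f g) m) (trans (⊛-distribʳ (f 0 • tail g) (tail f ⊛ g) h m)
                (cong₂ _+ℤ_ (•-⊛-assoc (f 0) (tail g) h m) (⊛-assoc (tail f) g h m)))
  assoc : ∀ a b c x y → (a *ℤ b +ℤ + 0) *ℤ c +ℤ (a *ℤ x +ℤ y) ≡ a *ℤ (b *ℤ c +ℤ x) +ℤ y
  assoc = solve-∀

⊛-identityʳ : ∀ f → f ⊛ 1S ≈S f
⊛-identityʳ f zero = trans (ℤ.+-identityʳ _) (ℤ.*-identityʳ (f 0))
⊛-identityʳ f (suc m) = begin
  (f ⊛ 1S) (suc m)                     ≡⟨ ⊛-suc f 1S m ⟩
  f 0 *ℤ + 0 +ℤ (tail f ⊛ 1S) m        ≡⟨ cong (_+ℤ (tail f ⊛ 1S) m) (ℤ.*-zeroʳ (f 0)) ⟩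
  + 0 +ℤ (tail f ⊛ 1S) m               ≡⟨ ℤ.+-identityˡ _ ⟩
  (tail f ⊛ 1S) m                      ≡⟨ ⊛-identityʳ (tail f) m ⟩
  f (suc m)                            ∎
  where open ≡-Reasoning

⊛-identityˡ : ∀ f → 1S ⊛ f ≈S f
⊛-identityˡ f m = trans (⊛-comm 1S f m) (⊛-identityʳ f m)

⊛-zeroʳ : ∀ f → f ⊛ 0S ≈S 0S
⊛-zeroʳ f m = trans (⊛-congʳ f (λ k → sym (ℤ.*-zeroˡ (+ 0))) m)
                (trans (⊛-•-comm (+ 0) f 0S m) (ℤ.*-zeroˡ ((f ⊛ 0S) m)))

⊛-zeroˡ : ∀ f → 0S ⊛ f ≈S 0S
⊛-zeroˡ f m = trans (⊛-comm 0S f m) (⊛-zeroʳ f m)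

⊝-as-• : ∀ f → ⊝ f ≈S ℤ.-1ℤ • f
⊝-as-• f m = sym (ℤ.-1*i≡-i (f m))

⊛-⊝-distrib : ∀ f g → f ⊛ ⊝ g ≈S ⊝ (f ⊛ g)
⊛-⊝-distrib f g m = trans (⊛-congʳ f (⊝-as-• g) m)
                      (trans (⊛-•-comm ℤ.-1ℤ f g m) (sym (⊝-as-• (f ⊛ g) m)))

⊝-⊛-distrib : ∀ f g → ⊝ f ⊛ g ≈S ⊝ (f ⊛ g)
⊝-⊛-distrib f g m = trans (⊛-comm (⊝ f) g m) (trans (⊛-⊝-distrib g f m) (cong -_ (⊛-comm g f m)))

⊛-interchange : ∀ a b c d → (a ⊛ b) ⊛ (c ⊛ d) ≈S (a ⊛ c) ⊛ (b ⊛ d)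
⊛-interchange a b c d = begin
  (a ⊛ b) ⊛ (c ⊛ d)    ≈⟨ ⊛-assoc a b (c ⊛ d) ⟩
  a ⊛ (b ⊛ (c ⊛ d))    ≈⟨ ⊛-congʳ a (⊛-assoc b c d) ⟨
  a ⊛ ((b ⊛ c) ⊛ d)    ≈⟨ ⊛-congʳ a (⊛-congˡ d (⊛-comm b c)) ⟩
  a ⊛ ((c ⊛ b) ⊛ d)    ≈⟨ ⊛-congʳ a (⊛-assoc c b d) ⟩
  a ⊛ (c ⊛ (b ⊛ d))    ≈⟨ ⊛-assoc a c (b ⊛ d) ⟨
  (a ⊛ c) ⊛ (b ⊛ d)    ∎
  where open ≈-Reasoning

invRev-downwards : ∀ f n → invRev f n ≡ map (λ k → inv f (n ∸ k)) (upTo (suc n))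
invRev-downwards f zero = refl
invRev-downwards f (suc n) = cong (inv f (suc n) ∷_) (begin
  invRev f n                                         ≡⟨ invRev-downwards f n ⟩
  map (λ k → inv f (n ∸ k)) (upTo (suc n))            ≡⟨ map-upTo (λ k → inv f (n ∸ k)) (suc n) ⟩
  applyUpTo (λ k → inv f (n ∸ k)) (suc n)             ≡⟨ map-applyUpTo suc (λ k → inv f (suc n ∸ k)) (suc n) ⟨
  map (λ k → inv f (suc n ∸ k)) (applyUpTo suc (suc n)) ∎)
  where open ≡-Reasoning

inv-suc : ∀ f n → inv f (suc n) ≡ - (f 0 *ℤ (tail f ⊛ inv f) n)
inv-suc f n = cong (λ xs → - (f 0 *ℤ sumℤ xs)) (begin
  zipWith _*ℤ_ (map (tail f) (upTo (suc n))) (invRev f n)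
    ≡⟨ cong (zipWith _*ℤ_ (map (tail f) (upTo (suc n)))) (invRev-downwards f n) ⟩
  zipWith _*ℤ_ (map (tail f) (upTo (suc n))) (map (λ k → inv f (n ∸ k)) (upTo (suc n)))
    ≡⟨ zipWith-map-map (tail f) (λ k → inv f (n ∸ k)) (upTo (suc n)) ⟩
  map (λ k → f (suc k) *ℤ inv f (n ∸ k)) (upTo (suc n)) ∎)
  where
  open ≡-Reasoning
  zipWith-map-map : ∀ (a b : ℕ → ℤ) xs → zipWith _*ℤ_ (map a xs) (map b xs) ≡ map (λ k → a k *ℤ b k) xs
  zipWith-map-map a b [] = refl
  zipWith-map-map a b (x ∷ xs) = cong (a x *ℤ b x ∷_) (zipWith-map-map a b xs)

⊛-inverseʳ : ∀ f → f 0 *ℤ f 0 ≡ + 1 → f ⊛ inv f ≈S 1S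
⊛-inverseʳ f f0²≡1 zero = trans (ℤ.+-identityʳ _) f0²≡1
⊛-inverseʳ f f0²≡1 (suc n) = begin
  (f ⊛ inv f) (suc n)                    ≡⟨ ⊛-suc f (inv f) n ⟩
  f 0 *ℤ inv f (suc n) +ℤ s              ≡⟨ cong (λ a → f 0 *ℤ a +ℤ s) (inv-suc f n) ⟩
  f 0 *ℤ - (f 0 *ℤ s) +ℤ s               ≡⟨ regroup (f 0) s ⟩
  - (f 0 *ℤ f 0) *ℤ s +ℤ s               ≡⟨ cong (λ a → - a *ℤ s +ℤ s) f0²≡1 ⟩
  ℤ.-1ℤ *ℤ s +ℤ s                         ≡⟨ cancel s ⟩
  + 0                                    ∎
  where
  open ≡-Reasoning
  s = (tail f ⊛ inv f) n
  regroup : ∀ a s → a *ℤ - (a *ℤ s) +ℤ s ≡ - (a *ℤ a) *ℤ s +ℤ s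
  regroup = solve-∀
  cancel : ∀ s → ℤ.-1ℤ *ℤ s +ℤ s ≡ + 0
  cancel = solve-∀

⊛-cancelʳ : ∀ {g h} f → f 0 *ℤ f 0 ≡ + 1 → g ⊛ f ≈S h ⊛ f → g ≈S h
⊛-cancelʳ {g} {h} f f0²≡1 gf≈hf = begin
  g                      ≈⟨ ⊛-identityʳ g ⟨
  g ⊛ 1S                 ≈⟨ ⊛-congʳ g (⊛-inverseʳ f f0²≡1) ⟨
  g ⊛ (f ⊛ inv f)        ≈⟨ ⊛-assoc g f (inv f) ⟨
  (g ⊛ f) ⊛ inv f        ≈⟨ ⊛-congˡ (inv f) gf≈hf ⟩
  (h ⊛ f) ⊛ inv f        ≈⟨ ⊛-assoc h f (inv f) ⟩
  h ⊛ (f ⊛ inv f)        ≈⟨ ⊛-congʳ h (⊛-inverseʳ f f0²≡1) ⟩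
  h ⊛ 1S                 ≈⟨ ⊛-identityʳ h ⟩
  h                      ∎
  where open ≈-Reasoning

inv-cong : ∀ {f g} → f ≈S g → inv f ≈S inv g
inv-cong {f} {g} f≈g n = cong headOr0 (invRev-cong n)
  where
  invRev-cong : ∀ n → invRev f n ≡ invRev g n
  invRev-cong zero = cong (_∷ []) (f≈g 0)
  invRev-cong (suc n) rewrite invRev-cong n | f≈g 0 | map-cong (f≈g ∘ suc) (upTo (suc n)) = refl

-- Finite sums and products

ΣS-applyUpTo-suc : ∀ n f F → ΣS (applyUpTo f (suc n)) F ≈S ΣS (applyUpTo f n) F ⊕ F (f n)
ΣS-applyUpTo-suc zero f F m = ℤ.+-comm (F (f 0) m) (+ 0)
ΣS-applyUpTo-suc (suc n) f F m = trans (cong (F (f 0) m +ℤ_) (ΣS-applyUpTo-suc n (f ∘ suc) F m))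
                                   (sym (ℤ.+-assoc (F (f 0) m) _ (F (f (suc n)) m)))

ΣS-applyUpTo-∘ : ∀ n f g F → ΣS (applyUpTo (f ∘ g) n) F ≈S ΣS (applyUpTo g n) (F ∘ f)
ΣS-applyUpTo-∘ zero f g F m = refl
ΣS-applyUpTo-∘ (suc n) f g F m = cong (F (f (g 0)) m +ℤ_) (ΣS-applyUpTo-∘ n f (g ∘ suc) F m)

ΣS-zero : ∀ (xs : List ℕ) F m → (∀ {x} → x ∈ xs → F x m ≡ + 0) → ΣS xs F m ≡ + 0
ΣS-zero [] F m zeros = refl
ΣS-zero (x ∷ xs) F m zeros = cong₂ _+ℤ_ (zeros (here refl)) (ΣS-zero xs F m (zeros ∘ there))

ΣS-single : ∀ {xs : List ℕ} {d} F m → Unique xs → d ∈ xs →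
            (∀ {x} → x ∈ xs → x ≢ d → F x m ≡ + 0) → ΣS xs F m ≡ F d m
ΣS-single {d ∷ xs} F m (d∉xs ∷ _) (here refl) others = trans
  (cong (F d m +ℤ_) (ΣS-zero xs F m (λ x∈xs → others (there x∈xs) (≢-sym (All.lookup d∉xs x∈xs)))))
  (ℤ.+-identityʳ (F d m))
ΣS-single {x ∷ xs} F m (x∉xs ∷ unique) (there d∈xs) others = trans
  (cong₂ _+ℤ_ (others (here refl) (All.lookup x∉xs d∈xs)) (ΣS-single F m unique d∈xs (others ∘ there)))
  (ℤ.+-identityˡ _)

ΠS-cong : ∀ {A : Set} (xs : List A) {G H : A → Series} → (∀ {x} → x ∈ xs → G x ≈S H x) → ΠS xs G ≈S ΠS xs H
ΠS-cong [] G≈H m = refl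
ΠS-cong (x ∷ xs) G≈H = ⊛-cong (G≈H (here refl)) (ΠS-cong xs (G≈H ∘ there))

ΠS-1 : ∀ {A : Set} (xs : List A) → ΠS xs (λ _ → 1S) ≈S 1S
ΠS-1 [] m = refl
ΠS-1 (x ∷ xs) m = trans (⊛-identityˡ (ΠS xs (λ _ → 1S)) m) (ΠS-1 xs m)

ΠS-⊛ : ∀ {A : Set} (xs : List A) (G H : A → Series) → ΠS xs (λ x → G x ⊛ H x) ≈S ΠS xs G ⊛ ΠS xs H
ΠS-⊛ [] G H m = sym (⊛-identityʳ 1S m)
ΠS-⊛ (x ∷ xs) G H m = trans (⊛-congʳ (G x ⊛ H x) (ΠS-⊛ xs G H) m)
                        (⊛-interchange (G x) (H x) (ΠS xs G) (ΠS xs H) m)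

ΠS-swap : ∀ {A B : Set} (xs : List A) (ys : List B) (G : A → B → Series) →
          ΠS xs (λ x → ΠS ys (G x)) ≈S ΠS ys (λ y → ΠS xs (λ x → G x y))
ΠS-swap [] ys G m = sym (ΠS-1 ys m)
ΠS-swap (x ∷ xs) ys G m = trans (⊛-congʳ (ΠS ys (G x)) (ΠS-swap xs ys G) m)
                            (sym (ΠS-⊛ ys (G x) (λ y → ΠS xs (λ x′ → G x′ y)) m))

ΠS-single : ∀ {A : Set} {xs : List A} {a} (G : A → Series) → Unique xs → a ∈ xs →
            (∀ {x} → x ∈ xs → x ≢ a → G x ≈S 1S) → ΠS xs G ≈S G a
ΠS-single {xs = a ∷ xs} G (a∉xs ∷ _) (here refl) others m = begin
  (G a ⊛ ΠS xs G) m      ≡⟨ ⊛-congʳ (G a) (≈S-trans (ΠS-cong xs rest≈1) (ΠS-1 xs)) m ⟩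
  (G a ⊛ 1S) m           ≡⟨ ⊛-identityʳ (G a) m ⟩
  G a m                  ∎
  where
  open ≡-Reasoning
  rest≈1 : ∀ {x} → x ∈ xs → G x ≈S 1S
  rest≈1 x∈xs = others (there x∈xs) (≢-sym (All.lookup a∉xs x∈xs))
ΠS-single {xs = x ∷ xs} {a} G (x∉xs ∷ unique) (there a∈xs) others m = begin
  (G x ⊛ ΠS xs G) m      ≡⟨ ⊛-cong (others (here refl) (All.lookup x∉xs a∈xs)) (ΠS-single G unique a∈xs (others ∘ there)) m ⟩
  (1S ⊛ G a) m           ≡⟨ ⊛-identityˡ (G a) m ⟩
  G a m                  ∎
  where open ≡-Reasoning

-- Monomials, intervals and geometric sums

shift : Series → Series
shift f zero = + 0
shift f (suc m) = f m

shift-cong : ∀ {f g} → f ≈S g → shift f ≈S shift g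
shift-cong f≈g zero = refl
shift-cong f≈g (suc m) = f≈g m

X^-cong : ∀ {a b} → a ≡ b → X^ a ≈S X^ b
X^-cong a≡b m = cong (λ k → X^ k m) a≡b

X^-zero : X^ 0 ≈S 1S
X^-zero zero = refl
X^-zero (suc m) = refl

X^-suc : ∀ k → X^ (suc k) ≈S shift (X^ k)
X^-suc k zero = refl
X^-suc k (suc m) = refl

X^-suc-⊛ : ∀ k f → X^ (suc k) ⊛ f ≈S shift (X^ k ⊛ f)
X^-suc-⊛ k f zero = refl
X^-suc-⊛ k f (suc m) = trans (⊛-suc (X^ (suc k)) f m) (ℤ.+-identityˡ _)

X^-zero-⊛ : ∀ f → X^ 0 ⊛ f ≈S f
X^-zero-⊛ f m = trans (⊛-congˡ f X^-zero m) (⊛-identityˡ f m)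

X^-⊛-X^ : ∀ a b → X^ a ⊛ X^ b ≈S X^ (a + b)
X^-⊛-X^ zero b = X^-zero-⊛ (X^ b)
X^-⊛-X^ (suc a) b m = trans (X^-suc-⊛ a (X^ b) m)
                        (trans (shift-cong (X^-⊛-X^ a b) m) (sym (X^-suc (a + b) m)))

X^-⊛-below : ∀ k f {m} → m < k → (X^ k ⊛ f) m ≡ + 0
X^-⊛-below (suc k) f {zero} _ = refl
X^-⊛-below (suc k) f {suc m} (s≤s m<k) = trans (X^-suc-⊛ k f (suc m)) (X^-⊛-below k f m<k)

X^-⊛-shifted : ∀ k f m → (X^ k ⊛ f) (k + m) ≡ f m
X^-⊛-shifted zero f m = X^-zero-⊛ f m
X^-⊛-shifted (suc k) f m = trans (X^-suc-⊛ k f (suc (k + m))) (X^-⊛-shifted k f m)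

X^-⊛-X^-1 : ∀ a d → X^ a ⊛ X^-1 d ≈S X^ (a + d) ⊕ ⊝ X^ a
X^-⊛-X^-1 a d m = trans (⊛-distribˡ (X^ a) (X^ d) (⊝ 1S) m)
  (cong₂ _+ℤ_ (X^-⊛-X^ a d m) (trans (⊛-⊝-distrib (X^ a) 1S m) (cong -_ (⊛-identityʳ (X^ a) m))))

⊛-X^-1-coeff : ∀ h k m → (h ⊛ X^-1 k) m ≡ (X^ k ⊛ h) m -ℤ h m
⊛-X^-1-coeff h k m = trans (⊛-comm h (X^-1 k) m) (trans (⊛-distribʳ (X^ k) (⊝ 1S) h m)
                       (cong ((X^ k ⊛ h) m +ℤ_) (trans (⊝-⊛-distrib 1S h m) (cong -_ (⊛-identityˡ h m)))))

X^-1-cancelʳ : ∀ {g h d} → 1 ≤ d → g ⊛ X^-1 d ≈S h ⊛ X^-1 d → g ≈S h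
X^-1-cancelʳ {d = suc d} _ = ⊛-cancelʳ (X^-1 (suc d)) refl

interval : ℕ → ℕ → Series
interval a zero = 0S
interval a (suc n) = X^ a ⊕ interval (suc a) n

ΣS-X^-interval : ∀ n a (f : ℕ → ℕ) → (∀ k → f k ≡ a + k) → ΣS (applyUpTo f n) X^ ≈S interval a n
ΣS-X^-interval zero a f f≗a+ m = refl
ΣS-X^-interval (suc n) a f f≗a+ = ⊕-cong (X^-cong (trans (f≗a+ 0) (ℕ.+-identityʳ a)))
  (ΣS-X^-interval n (suc a) (f ∘ suc) (λ k → trans (f≗a+ (suc k)) (ℕ.+-suc a k)))

interval-+ : ∀ a m n → interval a (m + n) ≈S interval a m ⊕ interval (a + m) n
interval-+ a zero n k = trans (cong (λ b → interval b n k) (sym (ℕ.+-identityʳ a))) (sym (ℤ.+-identityˡ _))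
interval-+ a (suc m) n k = begin
  X^ a k +ℤ interval (suc a) (m + n) k                              ≡⟨ cong (X^ a k +ℤ_) (interval-+ (suc a) m n k) ⟩
  X^ a k +ℤ (interval (suc a) m k +ℤ interval (suc a + m) n k)      ≡⟨ sym (ℤ.+-assoc (X^ a k) (interval (suc a) m k) _) ⟩
  X^ a k +ℤ interval (suc a) m k +ℤ interval (suc a + m) n k        ≡⟨ cong (λ b → X^ a k +ℤ interval (suc a) m k +ℤ interval b n k)
                                                                         (sym (ℕ.+-suc a m)) ⟩
  X^ a k +ℤ interval (suc a) m k +ℤ interval (a + suc m) n k        ∎
  where open ≡-Reasoning

interval-suc-zero : ∀ a n → interval (suc a) n 0 ≡ + 0
interval-suc-zero a zero = refl
interval-suc-zero a (suc n) = trans (ℤ.+-identityˡ _) (interval-suc-zero (suc a) n)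

X^-⊛-interval : ∀ c a n → X^ c ⊛ interval a n ≈S interval (c + a) n
X^-⊛-interval c a zero = ⊛-zeroʳ (X^ c)
X^-⊛-interval c a (suc n) m = trans (⊛-distribˡ (X^ c) (X^ a) (interval (suc a) n) m)
  (cong₂ _+ℤ_ (X^-⊛-X^ c a m)
    (trans (X^-⊛-interval c (suc a) n m) (cong (λ b → interval b n m) (ℕ.+-suc c a))))

interval-carry : ∀ b L m → interval b L ⊕ ⊝ interval b (L + m) ⊕ interval (b + L) (m + L) ≈S interval (b + L + m) L
interval-carry b L m k = begin
  I b L +ℤ - I b (L + m) +ℤ I (b + L) (m + L)
    ≡⟨ cong₂ (λ x y → I b L +ℤ - x +ℤ y) (interval-+ b L m k) (interval-+ (b + L) m L k) ⟩
  I b L +ℤ - (I b L +ℤ I (b + L) m) +ℤ (I (b + L) m +ℤ I (b + L + m) L)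
    ≡⟨ cancel (I b L) (I (b + L) m) (I (b + L + m) L) ⟩
  I (b + L + m) L
    ∎
  where
  open ≡-Reasoning
  I : ℕ → ℕ → ℤ
  I a n = interval a n k
  cancel : ∀ x y z → x +ℤ - (x +ℤ y) +ℤ (y +ℤ z) ≡ z
  cancel = solve-∀

geometric : ∀ d n b (f : ℕ → ℕ) → (∀ a → f a ≡ b + a * d) →
            ΣS (applyUpTo f n) X^ ⊛ X^-1 d ≈S X^ (b + n * d) ⊕ ⊝ X^ b
geometric d zero b f f≗ m = begin
  (0S ⊛ X^-1 d) m            ≡⟨ ⊛-zeroˡ (X^-1 d) m ⟩
  + 0                        ≡⟨ ℤ.+-inverseʳ (X^ b m) ⟨
  X^ b m -ℤ X^ b m           ≡⟨ cong (λ c → X^ c m -ℤ X^ b m) (ℕ.+-identityʳ b) ⟨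
  X^ (b + 0) m -ℤ X^ b m     ∎
  where open ≡-Reasoning
geometric d (suc n) b f f≗ m = begin
  ((X^ (f 0) ⊕ rest) ⊛ X^-1 d) m                     ≡⟨ ⊛-distribʳ (X^ (f 0)) rest (X^-1 d) m ⟩
  (X^ (f 0) ⊛ X^-1 d) m +ℤ (rest ⊛ X^-1 d) m         ≡⟨ cong₂ _+ℤ_ (⊛-congˡ (X^-1 d) (X^-cong (trans (f≗ 0) (ℕ.+-identityʳ b))) m)
                                                          (geometric d n (b + d) (f ∘ suc) f∘suc≗ m) ⟩
  (X^ b ⊛ X^-1 d) m +ℤ (X^ (b + d + n * d) m -ℤ X^ (b + d) m)
                                                      ≡⟨ cong (_+ℤ (X^ (b + d + n * d) m -ℤ X^ (b + d) m)) (X^-⊛-X^-1 b d m) ⟩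
  (X^ (b + d) m -ℤ X^ b m) +ℤ (X^ (b + d + n * d) m -ℤ X^ (b + d) m)
                                                      ≡⟨ telescope (X^ (b + d) m) (X^ b m) (X^ (b + d + n * d) m) ⟩
  X^ (b + d + n * d) m -ℤ X^ b m                     ≡⟨ cong (λ c → X^ c m -ℤ X^ b m) (ℕ.+-assoc b d (n * d)) ⟩
  X^ (b + suc n * d) m -ℤ X^ b m                     ∎
  where
  open ≡-Reasoning
  rest = ΣS (applyUpTo (f ∘ suc) n) X^
  f∘suc≗ : ∀ a → f (suc a) ≡ b + d + a * d
  f∘suc≗ a = trans (f≗ (suc a)) (sym (ℕ.+-assoc b d (a * d)))
  telescope : ∀ x y z → (x -ℤ y) +ℤ (z -ℤ x) ≡ z -ℤ y
  telescope = solve-∀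

repunit : ℕ → Series
repunit n = ΣS (upTo n) X^

repunit-zero : ∀ {n} → 1 ≤ n → repunit n 0 ≡ + 1
repunit-zero {suc n} _ = trans (ΣS-X^-interval (suc n) 0 id (λ _ → refl) 0)
                           (cong (+ 1 +ℤ_) (interval-suc-zero 0 n))

X^-⊛-repunit : ∀ c n → X^ c ⊛ repunit n ≈S interval c n
X^-⊛-repunit c n m = begin
  (X^ c ⊛ repunit n) m        ≡⟨ ⊛-congʳ (X^ c) (ΣS-X^-interval n 0 id (λ _ → refl)) m ⟩
  (X^ c ⊛ interval 0 n) m     ≡⟨ X^-⊛-interval c 0 n m ⟩
  interval (c + 0) n m        ≡⟨ cong (λ a → interval a n m) (ℕ.+-identityʳ c) ⟩
  interval c n m              ∎
  where open ≡-Reasoning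

repunit-⊛-X^-1 : ∀ n → repunit n ⊛ X^-1 1 ≈S X^-1 n
repunit-⊛-X^-1 n m = trans (geometric 1 n 0 id (λ a → sym (ℕ.*-identityʳ a)) m)
  (cong₂ (λ a b → a -ℤ b) (X^-cong (ℕ.*-identityʳ n) m) (X^-zero m))

dilatedRepunit : ℕ → ℕ → Series
dilatedRepunit d n = ΣS (upTo n) (λ a → X^ (a * d))

dilatedRepunit-⊛-X^-1 : ∀ d n → dilatedRepunit d n ⊛ X^-1 d ≈S X^-1 (n * d)
dilatedRepunit-⊛-X^-1 d n m = begin
  (dilatedRepunit d n ⊛ X^-1 d) m                        ≡⟨ ⊛-congˡ (X^-1 d) (≈S-sym (ΣS-applyUpTo-∘ n (_* d) id X^)) m ⟩
  (ΣS (applyUpTo (_* d) n) X^ ⊛ X^-1 d) m                ≡⟨ geometric d n 0 (_* d) (λ _ → refl) m ⟩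
  X^ (n * d) m -ℤ X^ 0 m                                 ≡⟨ cong (X^ (n * d) m -ℤ_) (X^-zero m) ⟩
  X^-1 (n * d) m                                         ∎
  where open ≡-Reasoning

-- Unfolding the cyclotomic polynomials

-- Verbatim the step of the well-founded recursion defining Φ, so that Φ n is definitionally
-- Φ-acc n (<-wellFounded n).
cyclotomicStep : (n : ℕ) → (∀ {m} → m < n → Series) → Series
cyclotomicStep n rec = X^-1 n ⊛ inv (ΠS (allFin n) (λ i → if does (toℕ i ∣? n) then rec (toℕ<n i) else 1S))

cyclotomicStep-cong : ∀ n {rec rec′ : ∀ {m} → m < n → Series} →
                      (∀ {m} (m<n : m < n) → rec m<n ≈S rec′ m<n) → cyclotomicStep n rec ≈S cyclotomicStep n rec′
cyclotomicStep-cong n rec≈rec′ = ⊛-congʳ (X^-1 n) (inv-cong (ΠS-cong (allFin n)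
  (λ {i} _ → if-cong (does (toℕ i ∣? n)) (rec≈rec′ (toℕ<n i)) ≈S-refl)))
  where
  if-cong : ∀ b {f f′ g g′} → f ≈S f′ → g ≈S g′ → (if b then f else g) ≈S (if b then f′ else g′)
  if-cong true f≈f′ _ = f≈f′
  if-cong false _ g≈g′ = g≈g′

Φ-acc : ∀ n → Acc _<_ n → Series
Φ-acc = Some.wfRec (λ _ → Series) cyclotomicStep

Φ-acc-irrelevant : ∀ {n} (q q′ : Acc _<_ n) → Φ-acc n q ≈S Φ-acc n q′
Φ-acc-irrelevant {n} (acc rs) (acc rs′) = cyclotomicStep-cong n (λ m<n → Φ-acc-irrelevant (rs m<n) (rs′ m<n))

properDivisorProduct : ℕ → (ℕ → Series) → Series
properDivisorProduct n F = ΠS (allFin n) (λ i → if does (toℕ i ∣? n) then F (toℕ i) else 1S)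

Φ-unfold : ∀ n → Φ n ≈S X^-1 n ⊛ inv (properDivisorProduct n Φ)
Φ-unfold n = unfold (<-wellFounded n)
  where
  unfold : (q : Acc _<_ n) → Φ-acc n q ≈S cyclotomicStep n (λ {m} _ → Φ m)
  unfold (acc rs) = cyclotomicStep-cong n (λ {m} m<n → Φ-acc-irrelevant (rs m<n) (<-wellFounded m))

properDivisorProduct-≈ : ∀ n (ds : List ℕ) F → Unique ds → (∀ {d} → d ∈ ds → d < n × d ∣ n) →
                         (∀ {d} → d < n → d ∣ n → d ∈ ds) → properDivisorProduct n F ≈S ΠS ds F
properDivisorProduct-≈ n ds F unique ds-divide divisors-in-ds = begin
  properDivisorProduct n F                             ≈⟨ ΠS-cong (allFin n) (λ {i} _ → factor i) ⟩
  ΠS (allFin n) (λ i → ΠS ds (λ d → pick d (toℕ i)))    ≈⟨ ΠS-swap (allFin n) ds (λ i d → pick d (toℕ i)) ⟩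
  ΠS ds (λ d → ΠS (allFin n) (λ i → pick d (toℕ i)))    ≈⟨ ΠS-cong ds column ⟩
  ΠS ds F                                              ∎
  where
  open ≈-Reasoning
  pick : ℕ → ℕ → Series
  pick d x = if does (x ℕ.≟ d) then F d else 1S
  pick-≢ : ∀ d x → x ≢ d → pick d x ≈S 1S
  pick-≢ d x x≢d = cong-app (if-no (x ℕ.≟ d) {F d} {1S} x≢d)
  pick-≡ : ∀ d → pick d d ≈S F d
  pick-≡ d = cong-app (if-yes (d ℕ.≟ d) {F d} {1S} refl)
  factor : ∀ i → (if does (toℕ i ∣? n) then F (toℕ i) else 1S) ≈S ΠS ds (λ d → pick d (toℕ i))
  factor i with toℕ i ∣? n
  ... | yes i∣n = ≈S-sym (≈S-trans (ΠS-single (λ d → pick d (toℕ i)) unique (divisors-in-ds (toℕ<n i) i∣n)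
                    (λ {d} _ d≢i → pick-≢ d (toℕ i) (≢-sym d≢i))) (pick-≡ (toℕ i)))
  ... | no i∤n = ≈S-sym (≈S-trans (ΠS-cong ds (λ {d} d∈ds → pick-≢ d (toℕ i) (λ { refl → i∤n (proj₂ (ds-divide d∈ds)) })))
                          (ΠS-1 ds))
  column : ∀ {d} → d ∈ ds → ΠS (allFin n) (λ i → pick d (toℕ i)) ≈S F d
  column {d} d∈ds = begin
    ΠS (allFin n) (λ i → pick d (toℕ i))   ≈⟨ ΠS-single (λ i → pick d (toℕ i)) (allFin⁺ n) (∈-allFin (fromℕ< d<n))
                                                 (λ {i} _ i≢d → pick-≢ d (toℕ i) (λ { refl → i≢d (toℕ-injective (sym (toℕ-fromℕ< d<n))) })) ⟩
    pick d (toℕ (fromℕ< d<n))              ≡⟨ cong (pick d) (toℕ-fromℕ< d<n) ⟩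
    pick d d                               ≈⟨ pick-≡ d ⟩
    F d                                    ∎
    where d<n = proj₁ (ds-divide d∈ds)

Φ-⊛-properDivisorProduct : ∀ n {P} → properDivisorProduct n Φ ≈S P → P 0 *ℤ P 0 ≡ + 1 → Φ n ⊛ P ≈S X^-1 n
Φ-⊛-properDivisorProduct n {P} D≈P P-unit = begin
  Φ n ⊛ P                                  ≈⟨ ⊛-congˡ P (Φ-unfold n) ⟩
  (X^-1 n ⊛ inv D) ⊛ P                     ≈⟨ ⊛-assoc (X^-1 n) (inv D) P ⟩
  X^-1 n ⊛ (inv D ⊛ P)                     ≈⟨ ⊛-congʳ (X^-1 n) (⊛-congˡ P (inv-cong D≈P)) ⟩
  X^-1 n ⊛ (inv P ⊛ P)                     ≈⟨ ⊛-congʳ (X^-1 n) (≈S-trans (⊛-comm (inv P) P) (⊛-inverseʳ P P-unit)) ⟩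
  X^-1 n ⊛ 1S                              ≈⟨ ⊛-identityʳ (X^-1 n) ⟩
  X^-1 n                                   ∎
  where
  open ≈-Reasoning
  D : Series
  D = properDivisorProduct n Φ

Φ-one : Φ 1 ≈S X^-1 1
Φ-one = ≈S-trans (≈S-sym (⊛-identityʳ (Φ 1)))
          (Φ-⊛-properDivisorProduct 1 (properDivisorProduct-≈ 1 [] Φ [] (λ ()) no-divisor) refl)
  where
  no-divisor : ∀ {d} → d < 1 → d ∣ 1 → d ∈ []
  no-divisor (s≤s z≤n) 0∣1 with () ← 0∣⇒≡0 0∣1

properDivisorProduct-prime : ∀ {p} → Prime p → properDivisorProduct p Φ ≈S X^-1 1
properDivisorProduct-prime {p} p-prime = begin
  properDivisorProduct p Φ   ≈⟨ properDivisorProduct-≈ p (1 ∷ []) Φ ([] ∷ []) one-divides divisor-is-one ⟩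
  Φ 1 ⊛ 1S                   ≈⟨ ⊛-identityʳ (Φ 1) ⟩
  Φ 1                        ≈⟨ Φ-one ⟩
  X^-1 1                     ∎
  where
  open ≈-Reasoning
  one-divides : ∀ {d} → d ∈ 1 ∷ [] → d < p × d ∣ p
  one-divides (here refl) = prime>1 p-prime , 1∣ p
  divisor-is-one : ∀ {d} → d < p → d ∣ p → d ∈ 1 ∷ []
  divisor-is-one d<p d∣p with prime⇒irreducible p-prime d∣p
  ... | inj₁ refl = here refl
  ... | inj₂ refl = contradiction d<p (ℕ.<-irrefl refl)

Φ-prime : ∀ {p} → Prime p → Φ p ≈S repunit p
Φ-prime {p} p-prime = X^-1-cancelʳ (s≤s z≤n) (begin
  Φ p ⊛ X^-1 1          ≈⟨ Φ-⊛-properDivisorProduct p (properDivisorProduct-prime p-prime) refl ⟩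
  X^-1 p                ≈⟨ repunit-⊛-X^-1 p ⟨
  repunit p ⊛ X^-1 1    ∎)
  where open ≈-Reasoning

properDivisorProduct-prime*prime : ∀ {p q} → Prime p → Prime q → p < q →
                                   properDivisorProduct (p * q) Φ ≈S X^-1 1 ⊛ (repunit p ⊛ (repunit q ⊛ 1S))
properDivisorProduct-prime*prime {p} {q} p-prime q-prime p<q = begin
  properDivisorProduct (p * q) Φ      ≈⟨ properDivisorProduct-≈ (p * q) divisors Φ distinct proper complete ⟩
  ΠS divisors Φ                       ≈⟨ ⊛-cong Φ-one (⊛-cong (Φ-prime p-prime) (⊛-congˡ 1S (Φ-prime q-prime))) ⟩
  X^-1 1 ⊛ (repunit p ⊛ (repunit q ⊛ 1S)) ∎
  where
  open ≈-Reasoning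
  1<p : 1 < p
  1<p = prime>1 p-prime
  1<q : 1 < q
  1<q = prime>1 q-prime
  p<pq : p < p * q
  p<pq = ℕ.m<m*n p q {{prime⇒nonZero p-prime}} 1<q
  divisors : List ℕ
  divisors = 1 ∷ p ∷ q ∷ []
  distinct : Unique divisors
  distinct = (ℕ.<⇒≢ 1<p ∷ ℕ.<⇒≢ 1<q ∷ []) ∷ (ℕ.<⇒≢ p<q ∷ []) ∷ [] ∷ []
  proper : ∀ {d} → d ∈ divisors → d < p * q × d ∣ p * q
  proper (here refl) = ℕ.<-trans 1<p p<pq , 1∣ (p * q)
  proper (there (here refl)) = p<pq , m∣m*n q
  proper (there (there (here refl))) = subst (q <_) (ℕ.*-comm q p) (ℕ.m<m*n q p {{prime⇒nonZero q-prime}} 1<p) , n∣m*n p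
  complete : ∀ {d} → d < p * q → d ∣ p * q → d ∈ divisors
  complete d<pq d∣pq with ∣-prime*prime p-prime q-prime d∣pq
  ... | inj₁ refl = here refl
  ... | inj₂ (inj₁ refl) = there (here refl)
  ... | inj₂ (inj₂ (inj₁ refl)) = there (there (here refl))
  ... | inj₂ (inj₂ (inj₂ refl)) = contradiction d<pq (ℕ.<-irrefl refl)

repunit-⊛-Φ-prime*prime : ∀ {p q} → Prime p → Prime q → p < q → repunit p ⊛ Φ (p * q) ≈S dilatedRepunit q p
repunit-⊛-Φ-prime*prime {p} {q} p-prime q-prime p<q = X^-1-cancelʳ (ℕ.<⇒≤ (prime>1 q-prime)) (begin
  (repunit p ⊛ Φ (p * q)) ⊛ X^-1 q                  ≈⟨ ⊛-congʳ (repunit p ⊛ Φ (p * q)) (repunit-⊛-X^-1 q) ⟨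
  (repunit p ⊛ Φ (p * q)) ⊛ (repunit q ⊛ X^-1 1)    ≈⟨ regroup (repunit p) (Φ (p * q)) (repunit q) (X^-1 1) ⟩
  Φ (p * q) ⊛ D                                     ≈⟨ Φ-⊛-properDivisorProduct (p * q)
                                                         (properDivisorProduct-prime*prime p-prime q-prime p<q) D-unit ⟩
  X^-1 (p * q)                                      ≈⟨ dilatedRepunit-⊛-X^-1 q p ⟨
  dilatedRepunit q p ⊛ X^-1 q                       ∎)
  where
  open ≈-Reasoning
  D : Series
  D = X^-1 1 ⊛ (repunit p ⊛ (repunit q ⊛ 1S))
  D-unit : D 0 *ℤ D 0 ≡ + 1
  D-unit rewrite repunit-zero (ℕ.<⇒≤ (prime>1 p-prime)) | repunit-zero (ℕ.<⇒≤ (prime>1 q-prime)) = refl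
  regroup : ∀ a c b x → (a ⊛ c) ⊛ (b ⊛ x) ≈S c ⊛ (x ⊛ (a ⊛ (b ⊛ 1S)))
  regroup a c b x = begin
    (a ⊛ c) ⊛ (b ⊛ x)        ≈⟨ ⊛-congˡ (b ⊛ x) (⊛-comm a c) ⟩
    (c ⊛ a) ⊛ (b ⊛ x)        ≈⟨ ⊛-assoc c a (b ⊛ x) ⟩
    c ⊛ (a ⊛ (b ⊛ x))        ≈⟨ ⊛-congʳ c (⊛-assoc a b x) ⟨
    c ⊛ ((a ⊛ b) ⊛ x)        ≈⟨ ⊛-congʳ c (⊛-comm (a ⊛ b) x) ⟩
    c ⊛ (x ⊛ (a ⊛ b))        ≈⟨ ⊛-congʳ c (⊛-congʳ x (⊛-congʳ a (⊛-identityʳ b))) ⟨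
    c ⊛ (x ⊛ (a ⊛ (b ⊛ 1S))) ∎

-- Truncation

𝒯-zero : ∀ h → 𝒯 (+ 0) h ≈S 0S
𝒯-zero h m = if-no (+ m ℤ.<? + 0) {h m} (λ { (ℤ.+<+ ()) })

𝒯-suc : ∀ n h → 𝒯 (+ suc n) h ≈S 𝒯 (+ n) h ⊕ h n • X^ n
𝒯-suc n h m with ℕ.<-cmp m n
... | tri< m<n m≢n _ = begin
  𝒯 (+ suc n) h m                       ≡⟨ if-yes (+ m ℤ.<? + suc n) (ℤ.+<+ (ℕ.m≤n⇒m≤1+n m<n)) ⟩
  h m                                   ≡⟨ ℤ.+-identityʳ (h m) ⟨
  h m +ℤ + 0                            ≡⟨ cong (h m +ℤ_) (ℤ.*-zeroʳ (h n)) ⟨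
  h m +ℤ h n *ℤ + 0                     ≡⟨ cong₂ (λ x y → x +ℤ h n *ℤ y) (if-yes (+ m ℤ.<? + n) (ℤ.+<+ m<n))
                                                                         (𝟙-no (m ℕ.≟ n) m≢n) ⟨
  (𝒯 (+ n) h ⊕ h n • X^ n) m            ∎
  where open ≡-Reasoning
... | tri≈ _ refl _ = begin
  𝒯 (+ suc n) h n                       ≡⟨ if-yes (+ n ℤ.<? + suc n) (ℤ.+<+ ℕ.≤-refl) ⟩
  h n                                   ≡⟨ ℤ.*-identityʳ (h n) ⟨
  h n *ℤ + 1                            ≡⟨ ℤ.+-identityˡ _ ⟨
  + 0 +ℤ h n *ℤ + 1                     ≡⟨ cong₂ (λ x y → x +ℤ h n *ℤ y) (if-no (+ n ℤ.<? + n) (ℤ.<-irrefl refl))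
                                                                         (𝟙-yes (n ℕ.≟ n) refl) ⟨
  (𝒯 (+ n) h ⊕ h n • X^ n) n            ∎
  where open ≡-Reasoning
... | tri> _ m≢n n<m = begin
  𝒯 (+ suc n) h m                       ≡⟨ if-no (+ m ℤ.<? + suc n) (λ m<n+1 → ℕ.<⇒≱ n<m (ℕ.m<1+n⇒m≤n (ℤ.drop‿+<+ m<n+1))) ⟩
  + 0                                   ≡⟨ ℤ.*-zeroʳ (h n) ⟨
  h n *ℤ + 0                            ≡⟨ ℤ.+-identityˡ _ ⟨
  + 0 +ℤ h n *ℤ + 0                     ≡⟨ cong₂ (λ x y → x +ℤ h n *ℤ y) (if-no (+ m ℤ.<? + n) (ℕ.<⇒≯ n<m ∘ ℤ.drop‿+<+))
                                                                         (𝟙-no (m ℕ.≟ n) m≢n) ⟨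
  (𝒯 (+ n) h ⊕ h n • X^ n) m            ∎
  where open ≡-Reasoning

𝒯-⊝X : ∀ s → 𝒯 s (⊝ X^ 1) ≈S (- 𝟙 (+ 1 ℤ.<? s)) • X^ 1
𝒯-⊝X s zero = trans (if-same (+ 0 ℤ.<? s)) (sym (ℤ.*-zeroʳ (- 𝟙 (+ 1 ℤ.<? s))))
𝒯-⊝X s (suc zero) with + 1 ℤ.<? s
... | yes _ = refl
... | no _ = refl
𝒯-⊝X s (suc (suc m)) = trans (if-same (+ suc (suc m) ℤ.<? s)) (sym (ℤ.*-zeroʳ (- 𝟙 (+ 1 ℤ.<? s))))

-- Φ (p P) for primes p < P = 1 + q p, and the partial products of the theorem

module SemiprimeCyclotomic {p q : ℕ} (p-prime : Prime p) (P-prime : Prime (suc (q * p))) (p<P : p < suc (q * p)) where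

  private
    instance
      p≢0 : NonZero p
      p≢0 = prime⇒nonZero p-prime
    P : ℕ
    P = suc (q * p)
    C A : Series
    C = Φ (p * P)
    A = dilatedRepunit P p
    Δ : ℕ → ℤ
    Δ m = A m -ℤ (X^ 1 ⊛ A) m

    p∸1+1 : suc (p ∸ 1) ≡ p
    p∸1+1 = ℕ.suc-pred p

    suc-*-p : ∀ N → suc N * p ≡ suc (N * p + (p ∸ 1))
    suc-*-p N = begin
      p + N * p               ≡⟨ ℕ.+-comm p (N * p) ⟩
      N * p + p               ≡⟨ cong (λ x → N * p + x) p∸1+1 ⟨
      N * p + suc (p ∸ 1)     ≡⟨ ℕ.+-suc (N * p) (p ∸ 1) ⟩
      suc (N * p + (p ∸ 1))   ∎
      where open ≡-Reasoning

    *-P : ∀ a → a * P ≡ a * q * p + a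
    *-P a = solve a q p
      where
      solve : ∀ a q p → a * suc (q * p) ≡ a * q * p + a
      solve = ℕS.solve-∀

  Φ-⊛-X^-1 : C ⊛ X^-1 p ≈S A ⊛ X^-1 1
  Φ-⊛-X^-1 = begin
    C ⊛ X^-1 p                   ≈⟨ ⊛-congʳ C (repunit-⊛-X^-1 p) ⟨
    C ⊛ (repunit p ⊛ X^-1 1)     ≈⟨ ⊛-assoc C (repunit p) (X^-1 1) ⟨
    (C ⊛ repunit p) ⊛ X^-1 1     ≈⟨ ⊛-congˡ (X^-1 1) (≈S-trans (⊛-comm C (repunit p))
                                      (repunit-⊛-Φ-prime*prime p-prime P-prime p<P)) ⟩
    A ⊛ X^-1 1                   ∎
    where open ≈-Reasoning

  Φ-recurrence : ∀ m → C m ≡ (X^ p ⊛ C) m +ℤ Δ m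
  Φ-recurrence m = begin
    C m                                        ≡⟨ solve-c (C m) ((X^ p ⊛ C) m) ⟩
    (X^ p ⊛ C) m -ℤ ((X^ p ⊛ C) m -ℤ C m)      ≡⟨ cong ((X^ p ⊛ C) m -ℤ_) (trans (sym (⊛-X^-1-coeff C p m))
                                                    (trans (Φ-⊛-X^-1 m) (⊛-X^-1-coeff A 1 m))) ⟩
    (X^ p ⊛ C) m -ℤ ((X^ 1 ⊛ A) m -ℤ A m)      ≡⟨ solve-Δ ((X^ p ⊛ C) m) ((X^ 1 ⊛ A) m) (A m) ⟩
    (X^ p ⊛ C) m +ℤ Δ m                        ∎
    where
    open ≡-Reasoning
    solve-c : ∀ c x → c ≡ x -ℤ (x -ℤ c)
    solve-c = solve-∀
    solve-Δ : ∀ x y a → x -ℤ (y -ℤ a) ≡ x +ℤ (a -ℤ y)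
    solve-Δ = solve-∀

  private
    C-shift : ∀ m → C (p + m) ≡ C m +ℤ Δ (p + m)
    C-shift m = trans (Φ-recurrence (p + m)) (cong (_+ℤ Δ (p + m)) (X^-⊛-shifted p C m))

    C-below : ∀ {m} → m < p → C m ≡ Δ m
    C-below {m} m<p = trans (Φ-recurrence m) (trans (cong (_+ℤ Δ m) (X^-⊛-below p C m<p)) (ℤ.+-identityˡ (Δ m)))

  A-coeff : ∀ M {r} → r < p → A (M * p + r) ≡ 𝟙 (M ℕ.≟ r * q)
  A-coeff M {r} r<p = trans (ΣS-single (λ a → X^ (a * P)) (M * p + r) (upTo⁺ p) (∈-upTo⁺ r<p) others) diagonal
    where
    others : ∀ {a} → a ∈ upTo p → a ≢ r → X^ (a * P) (M * p + r) ≡ + 0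
    others {a} a∈ a≢r = 𝟙-no (M * p + r ℕ.≟ a * P)
      (λ eq → a≢r (sym (proj₂ (euclid-unique {M = M} {N = a * q} r<p (∈-upTo⁻ a∈) (trans eq (*-P a))))))
    diagonal : X^ (r * P) (M * p + r) ≡ 𝟙 (M ℕ.≟ r * q)
    diagonal with M ℕ.≟ r * q
    ... | yes refl = trans (𝟙-yes (M * p + r ℕ.≟ r * P) (sym (*-P r))) (sym (𝟙-yes (M ℕ.≟ M) refl))
    ... | no M≢rq = trans (𝟙-no (M * p + r ℕ.≟ r * P) (λ eq → M≢rq (proj₁ (euclid-unique {M = M} {N = r * q} r<p r<p (trans eq (*-P r))))))
                      (sym (𝟙-no (M ℕ.≟ r * q) M≢rq))

  private
    Δ-zero : Δ 0 ≡ + 1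
    Δ-zero = cong (_-ℤ (X^ 1 ⊛ A) 0) (A-coeff 0 (ℕ.<-trans (s≤s z≤n) (prime>1 p-prime)))

    Δ-row : ∀ M {r} → suc r < p → Δ (M * p + suc r) ≡ 𝟙 (M ℕ.≟ suc r * q) -ℤ 𝟙 (M ℕ.≟ r * q)
    Δ-row M {r} r+1<p = cong₂ _-ℤ_ (A-coeff M r+1<p) (begin
      (X^ 1 ⊛ A) (M * p + suc r)      ≡⟨ cong (X^ 1 ⊛ A) (ℕ.+-suc (M * p) r) ⟩
      (X^ 1 ⊛ A) (1 + (M * p + r))    ≡⟨ X^-⊛-shifted 1 A (M * p + r) ⟩
      A (M * p + r)                   ≡⟨ A-coeff M (ℕ.<-trans (ℕ.n<1+n r) r+1<p) ⟩
      𝟙 (M ℕ.≟ r * q)                 ∎)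
      where open ≡-Reasoning

    Δ-multiple : ∀ {N} → N < (p ∸ 1) * q → Δ (suc N * p) ≡ + 0
    Δ-multiple {N} N<top = cong₂ _-ℤ_ (trans (cong A (sym (ℕ.+-identityʳ (suc N * p)))) (A-coeff (suc N) p>0)) (begin
      (X^ 1 ⊛ A) (suc N * p)                  ≡⟨ cong (X^ 1 ⊛ A) (suc-*-p N) ⟩
      (X^ 1 ⊛ A) (1 + (N * p + (p ∸ 1)))      ≡⟨ X^-⊛-shifted 1 A (N * p + (p ∸ 1)) ⟩
      A (N * p + (p ∸ 1))                     ≡⟨ A-coeff N (subst (p ∸ 1 <_) p∸1+1 (ℕ.n<1+n (p ∸ 1))) ⟩
      𝟙 (N ℕ.≟ (p ∸ 1) * q)                   ≡⟨ 𝟙-no (N ℕ.≟ (p ∸ 1) * q) (ℕ.<⇒≢ N<top) ⟩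
      + 0                                     ∎)
      where
      open ≡-Reasoning
      p>0 : 0 < p
      p>0 = ℕ.<-trans (s≤s z≤n) (prime>1 p-prime)

  Φ-coeff-multiple : ∀ N → N ≤ (p ∸ 1) * q → C (N * p) ≡ + 1
  Φ-coeff-multiple zero _ = trans (C-below (ℕ.<-trans (s≤s z≤n) (prime>1 p-prime))) Δ-zero
  Φ-coeff-multiple (suc N) N+1≤top = begin
    C (p + N * p)                   ≡⟨ C-shift (N * p) ⟩
    C (N * p) +ℤ Δ (suc N * p)      ≡⟨ cong₂ _+ℤ_ (Φ-coeff-multiple N (ℕ.<⇒≤ N+1≤top)) (Δ-multiple N+1≤top) ⟩
    + 1                             ∎
    where open ≡-Reasoning

  Φ-coeff-row : ∀ N {r} → suc r < p → C (N * p + suc r) ≡ 𝟙 (suc r * q ℕ.≤? N) -ℤ 𝟙 (r * q ℕ.≤? N)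
  Φ-coeff-row zero {r} r+1<p = begin
    C (suc r)                                               ≡⟨ C-below r+1<p ⟩
    Δ (0 * p + suc r)                                       ≡⟨ Δ-row 0 r+1<p ⟩
    𝟙 (0 ℕ.≟ suc r * q) -ℤ 𝟙 (0 ℕ.≟ r * q)                  ≡⟨ cong₂ _-ℤ_ (𝟙-≤-zero (suc r * q)) (𝟙-≤-zero (r * q)) ⟨
    𝟙 (suc r * q ℕ.≤? 0) -ℤ 𝟙 (r * q ℕ.≤? 0)                ∎
    where open ≡-Reasoning
  Φ-coeff-row (suc N) {r} r+1<p = begin
    C (suc N * p + suc r)                                   ≡⟨ cong C (ℕ.+-assoc p (N * p) (suc r)) ⟩
    C (p + (N * p + suc r))                                 ≡⟨ C-shift (N * p + suc r) ⟩
    C (N * p + suc r) +ℤ Δ (p + (N * p + suc r))            ≡⟨ cong₂ _+ℤ_ (Φ-coeff-row N r+1<p)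
                                                                 (trans (cong Δ (sym (ℕ.+-assoc p (N * p) (suc r)))) (Δ-row (suc N) r+1<p)) ⟩
    (a N -ℤ b N) +ℤ (𝟙 (suc N ℕ.≟ suc r * q) -ℤ 𝟙 (suc N ℕ.≟ r * q))
                                                            ≡⟨ regroup (a N) (b N) _ _ ⟩
    (a N +ℤ 𝟙 (suc N ℕ.≟ suc r * q)) -ℤ (b N +ℤ 𝟙 (suc N ℕ.≟ r * q))
                                                            ≡⟨ cong₂ _-ℤ_ (𝟙-≤-suc (suc r * q) N) (𝟙-≤-suc (r * q) N) ⟨
    a (suc N) -ℤ b (suc N)                                  ∎
    where
    open ≡-Reasoning
    a b : ℕ → ℤ
    a n = 𝟙 (suc r * q ℕ.≤? n)
    b n = 𝟙 (r * q ℕ.≤? n)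
    regroup : ∀ a b c d → (a -ℤ b) +ℤ (c -ℤ d) ≡ (a +ℤ c) -ℤ (b +ℤ d)
    regroup = solve-∀

  partialProduct : ℕ → Series
  partialProduct n = repunit p ⊛ 𝒯 (+ n) C

  partialProduct-zero : partialProduct 0 ≈S 0S
  partialProduct-zero = ≈S-trans (⊛-congʳ (repunit p) (𝒯-zero C)) (⊛-zeroʳ (repunit p))

  partialProduct-suc : ∀ n → partialProduct (suc n) ≈S partialProduct n ⊕ C n • interval n p
  partialProduct-suc n = begin
    repunit p ⊛ 𝒯 (+ suc n) C                          ≈⟨ ⊛-congʳ (repunit p) (𝒯-suc n C) ⟩
    repunit p ⊛ (𝒯 (+ n) C ⊕ C n • X^ n)               ≈⟨ ⊛-distribˡ (repunit p) (𝒯 (+ n) C) (C n • X^ n) ⟩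
    partialProduct n ⊕ repunit p ⊛ (C n • X^ n)        ≈⟨ ⊕-cong (≈S-refl {partialProduct n}) (⊛-•-comm (C n) (repunit p) (X^ n)) ⟩
    partialProduct n ⊕ C n • (repunit p ⊛ X^ n)        ≈⟨ ⊕-cong (≈S-refl {partialProduct n}) (•-congʳ (C n) (≈S-trans (⊛-comm (repunit p) (X^ n))
                                                                                              (X^-⊛-repunit n p))) ⟩
    partialProduct n ⊕ C n • interval n p              ∎
    where open ≈-Reasoning

  -- Normal form of the right-hand side within row k = i₁ q + i₂ of the walk; c is -1 while
  -- the negative block opened at i₃ = i₁ + 1 is present and 0 otherwise.
  rhs : ℕ → ℕ → ℤ → Series
  rhs i₁ k c = ΣS (upTo (suc i₁)) (λ a → X^ (a * P))
               ⊕ interval (k * p + suc i₁) (p ∸ 1 ∸ i₁)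
               ⊕ c • interval (k * p + suc i₁) p

  rhs-add : ∀ i₁ k c {c′ s} → c′ ≡ + 0 ⊎ s ≡ k * p + suc i₁ →
            rhs i₁ k c ⊕ c′ • interval s p ≈S rhs i₁ k (c +ℤ c′)
  rhs-add i₁ k c {c′} {s} aligned m = begin
    S +ℤ T +ℤ c *ℤ I +ℤ c′ *ℤ interval s p m    ≡⟨ cong (S +ℤ T +ℤ c *ℤ I +ℤ_) (aligned-term aligned) ⟩
    S +ℤ T +ℤ c *ℤ I +ℤ c′ *ℤ I                 ≡⟨ distrib S T c c′ I ⟩
    S +ℤ T +ℤ (c +ℤ c′) *ℤ I                    ∎
    where
    open ≡-Reasoning
    S = ΣS (upTo (suc i₁)) (λ a → X^ (a * P)) m
    T = interval (k * p + suc i₁) (p ∸ 1 ∸ i₁) m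
    I = interval (k * p + suc i₁) p m
    aligned-term : c′ ≡ + 0 ⊎ s ≡ k * p + suc i₁ → c′ *ℤ interval s p m ≡ c′ *ℤ I
    aligned-term (inj₁ refl) = trans (ℤ.*-zeroˡ (interval s p m)) (sym (ℤ.*-zeroˡ I))
    aligned-term (inj₂ refl) = refl
    distrib : ∀ s t c c′ x → s +ℤ t +ℤ c *ℤ x +ℤ c′ *ℤ x ≡ s +ℤ t +ℤ (c +ℤ c′) *ℤ x
    distrib = solve-∀

  private
    gap+i₁+1≡p : ∀ {i₁} → i₁ < p → (p ∸ 1 ∸ i₁) + suc i₁ ≡ p
    gap+i₁+1≡p {i₁} i₁<p = begin
      (p ∸ 1 ∸ i₁) + suc i₁    ≡⟨ ℕ.+-suc (p ∸ 1 ∸ i₁) i₁ ⟩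
      suc (p ∸ 1 ∸ i₁ + i₁)    ≡⟨ cong suc (ℕ.m∸n+n≡m (ℕ.≤-pred (subst (suc i₁ ≤_) (sym p∸1+1) i₁<p))) ⟩
      suc (p ∸ 1)              ≡⟨ p∸1+1 ⟩
      p                        ∎
      where open ≡-Reasoning

  rhs-carry : ∀ i₁ k → i₁ < p → rhs i₁ k ℤ.-1ℤ ⊕ interval (suc k * p) p ≈S rhs i₁ (suc k) (+ 0)
  rhs-carry i₁ k i₁<p m = begin
    S +ℤ I b L +ℤ ℤ.-1ℤ *ℤ I b p +ℤ I (suc k * p) p
      ≡⟨ cong₂ (λ x y → S +ℤ I b L +ℤ ℤ.-1ℤ *ℤ I b x +ℤ y) (sym L+m′≡p) (cong₂ I (sym b+L≡) (sym m′+L≡p)) ⟩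
    S +ℤ I b L +ℤ ℤ.-1ℤ *ℤ I b (L + m′) +ℤ I (b + L) (m′ + L)
      ≡⟨ regroup S (I b L) (I b (L + m′)) (I (b + L) (m′ + L)) ⟩
    S +ℤ (I b L +ℤ - I b (L + m′) +ℤ I (b + L) (m′ + L))
      ≡⟨ cong (S +ℤ_) (interval-carry b L m′ m) ⟩
    S +ℤ I (b + L + m′) L
      ≡⟨ cong (λ x → S +ℤ I (x + m′) L) b+L≡ ⟩
    S +ℤ I (suc k * p + suc i₁) L
      ≡⟨ pad S (I (suc k * p + suc i₁) L) (I (suc k * p + suc i₁) p) ⟩
    S +ℤ I (suc k * p + suc i₁) L +ℤ + 0 *ℤ I (suc k * p + suc i₁) p
      ∎
    where
    open ≡-Reasoning
    S = ΣS (upTo (suc i₁)) (λ a → X^ (a * P)) m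
    I : ℕ → ℕ → ℤ
    I a n = interval a n m
    b = k * p + suc i₁
    L = p ∸ 1 ∸ i₁
    m′ = suc i₁
    L+m′≡p : L + m′ ≡ p
    L+m′≡p = gap+i₁+1≡p i₁<p
    m′+L≡p : m′ + L ≡ p
    m′+L≡p = trans (ℕ.+-comm m′ L) L+m′≡p
    b+L≡ : b + L ≡ suc k * p
    b+L≡ = begin
      k * p + m′ + L          ≡⟨ ℕ.+-assoc (k * p) m′ L ⟩
      k * p + (m′ + L)        ≡⟨ cong (λ x → k * p + x) m′+L≡p ⟩
      k * p + p               ≡⟨ ℕ.+-comm (k * p) p ⟩
      suc k * p               ∎
    regroup : ∀ s x y z → s +ℤ x +ℤ ℤ.-1ℤ *ℤ y +ℤ z ≡ s +ℤ (x +ℤ - y +ℤ z)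
    regroup = solve-∀
    pad : ∀ s x y → s +ℤ x ≡ s +ℤ x +ℤ + 0 *ℤ y
    pad = solve-∀

  rhs-next : ∀ i₁ k → i₁ < p ∸ 1 → suc i₁ * P ≡ k * p + suc i₁ → rhs i₁ k (+ 0) ≈S rhs (suc i₁) k (+ 0)
  rhs-next i₁ k i₁<p-1 i₁+1-th m = begin
    S +ℤ I b (p ∸ 1 ∸ i₁) +ℤ + 0 *ℤ I b p
      ≡⟨ cong (λ n → S +ℤ I b n +ℤ + 0 *ℤ I b p) (ℕ.+-∸-assoc 1 i₁<p-1) ⟩
    S +ℤ (X^ b m +ℤ I (suc b) L′) +ℤ + 0 *ℤ I b p
      ≡⟨ regroup S (X^ b m) (I (suc b) L′) (I b p) (I (suc b) p) ⟩
    S +ℤ X^ b m +ℤ I (suc b) L′ +ℤ + 0 *ℤ I (suc b) p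
      ≡⟨ cong₂ (λ x y → x +ℤ I y L′ +ℤ + 0 *ℤ I y p)
           (sym (trans (ΣS-applyUpTo-suc (suc i₁) id (λ a → X^ (a * P)) m) (cong (λ x → S +ℤ X^ x m) i₁+1-th)))
           (sym (ℕ.+-suc (k * p) (suc i₁))) ⟩
    rhs (suc i₁) k (+ 0) m
      ∎
    where
    open ≡-Reasoning
    S = ΣS (upTo (suc i₁)) (λ a → X^ (a * P)) m
    I : ℕ → ℕ → ℤ
    I a n = interval a n m
    b = k * p + suc i₁
    L′ = p ∸ 1 ∸ suc i₁
    regroup : ∀ s x y z w → s +ℤ (x +ℤ y) +ℤ + 0 *ℤ z ≡ s +ℤ x +ℤ y +ℤ + 0 *ℤ w
    regroup = solve-∀

  row : ℕ → ℕ → ℕ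
  row i₁ i₂ = i₁ * q + i₂

  Φ-coeff-in-row : ∀ i₁ {i₂ i₃} → i₂ < q → suc i₃ < p → C (row i₁ i₂ * p + suc i₃) ≡ - 𝟙 (i₃ ℕ.≟ i₁)
  Φ-coeff-in-row i₁ {i₂} {i₃} i₂<q i₃+1<p = begin
    C (row i₁ i₂ * p + suc i₃)                                ≡⟨ Φ-coeff-row (row i₁ i₂) i₃+1<p ⟩
    𝟙 (suc i₃ * q ℕ.≤? row i₁ i₂) -ℤ 𝟙 (i₃ * q ℕ.≤? row i₁ i₂) ≡⟨ cong₂ _-ℤ_ (𝟙-≤-scaled q (suc i₃) i₁ i₂<q) (𝟙-≤-scaled q i₃ i₁ i₂<q) ⟩
    𝟙 (suc i₃ ℕ.≤? i₁) -ℤ 𝟙 (i₃ ℕ.≤? i₁)                      ≡⟨ cong₂ _-ℤ_ (𝟙-≤-complement (suc i₃) i₁) (𝟙-≤-complement i₃ i₁) ⟩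
    (+ 1 -ℤ 𝟙 (i₁ ℕ.<? suc i₃)) -ℤ (+ 1 -ℤ 𝟙 (i₁ ℕ.<? i₃))    ≡⟨ cong (λ x → (+ 1 -ℤ x) -ℤ (+ 1 -ℤ 𝟙 (i₁ ℕ.<? i₃))) (𝟙-≤-suc (suc i₁) i₃) ⟩
    (+ 1 -ℤ (a +ℤ e)) -ℤ (+ 1 -ℤ a)                            ≡⟨ cancel a e ⟩
    - e                                                        ∎
    where
    open ≡-Reasoning
    a = 𝟙 (i₁ ℕ.<? i₃)
    e = 𝟙 (i₃ ℕ.≟ i₁)
    cancel : ∀ a e → (+ 1 -ℤ (a +ℤ e)) -ℤ (+ 1 -ℤ a) ≡ - e
    cancel = solve-∀

  partialProduct-step : ∀ i₁ {i₂ i₃} → i₂ < q → suc i₃ < p →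
    partialProduct (suc (row i₁ i₂ * p + i₃)) ≈S rhs i₁ (row i₁ i₂) (- 𝟙 (i₁ ℕ.<? i₃)) →
    partialProduct (suc (row i₁ i₂ * p + suc i₃)) ≈S rhs i₁ (row i₁ i₂) (- 𝟙 (i₁ ℕ.<? suc i₃))
  partialProduct-step i₁ {i₂} {i₃} i₂<q i₃+1<p previous = begin
    partialProduct (suc (k * p + suc i₃))              ≡⟨ cong (partialProduct ∘ suc) (ℕ.+-suc (k * p) i₃) ⟩
    partialProduct (suc n)                             ≈⟨ partialProduct-suc n ⟩
    partialProduct n ⊕ C n • interval n p              ≈⟨ ⊕-cong previous (•-congˡ (interval n p) coefficient) ⟩
    rhs i₁ k c ⊕ (- e) • interval n p                  ≈⟨ rhs-add i₁ k c aligned ⟩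
    rhs i₁ k (c +ℤ - e)                                ≡⟨ cong (rhs i₁ k) c-step ⟩
    rhs i₁ k (- 𝟙 (i₁ ℕ.<? suc i₃))                    ∎
    where
    open ≈-Reasoning
    k = row i₁ i₂
    n = suc (k * p + i₃)
    c = - 𝟙 (i₁ ℕ.<? i₃)
    e = 𝟙 (i₃ ℕ.≟ i₁)
    coefficient : C n ≡ - e
    coefficient = trans (cong C (sym (ℕ.+-suc (k * p) i₃))) (Φ-coeff-in-row i₁ i₂<q i₃+1<p)
    aligned : - e ≡ + 0 ⊎ n ≡ k * p + suc i₁
    aligned with i₃ ℕ.≟ i₁
    ... | yes refl = inj₂ (sym (ℕ.+-suc (k * p) i₃))
    ... | no i₃≢i₁ = inj₁ (cong -_ (𝟙-no (i₃ ℕ.≟ i₁) i₃≢i₁))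
    c-step : c +ℤ - e ≡ - 𝟙 (i₁ ℕ.<? suc i₃)
    c-step = trans (sym (ℤ.neg-distrib-+ (𝟙 (i₁ ℕ.<? i₃)) e)) (cong -_ (sym (𝟙-≤-suc (suc i₁) i₃)))

  partialProduct-carry : ∀ i₁ k → i₁ < p → suc k ≤ (p ∸ 1) * q →
    partialProduct (suc (k * p + (p ∸ 1))) ≈S rhs i₁ k ℤ.-1ℤ →
    partialProduct (suc (suc k * p + 0)) ≈S rhs i₁ (suc k) (+ 0)
  partialProduct-carry i₁ k i₁<p bound previous = begin
    partialProduct (suc (suc k * p + 0))                      ≡⟨ cong (partialProduct ∘ suc) (ℕ.+-identityʳ (suc k * p)) ⟩
    partialProduct (suc (suc k * p))                          ≈⟨ partialProduct-suc (suc k * p) ⟩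
    partialProduct (suc k * p) ⊕ C (suc k * p) • I            ≡⟨ cong (λ n → partialProduct n ⊕ C (suc k * p) • I) (suc-*-p k) ⟩
    partialProduct (suc (k * p + (p ∸ 1))) ⊕ C (suc k * p) • I ≈⟨ ⊕-cong previous (•-congˡ I (Φ-coeff-multiple (suc k) bound)) ⟩
    rhs i₁ k ℤ.-1ℤ ⊕ (+ 1) • I                                ≈⟨ ⊕-cong (≈S-refl {rhs i₁ k ℤ.-1ℤ}) (λ m → ℤ.*-identityˡ (I m)) ⟩
    rhs i₁ k ℤ.-1ℤ ⊕ I                                        ≈⟨ rhs-carry i₁ k i₁<p ⟩
    rhs i₁ (suc k) (+ 0)                                      ∎
    where
    open ≈-Reasoning
    I = interval (suc k * p) p

  partialProduct-start : partialProduct 1 ≈S rhs 0 0 (+ 0)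
  partialProduct-start = begin
    partialProduct 1                                ≈⟨ partialProduct-suc 0 ⟩
    partialProduct 0 ⊕ C 0 • interval 0 p           ≈⟨ ⊕-cong partialProduct-zero (•-congˡ (interval 0 p) (Φ-coeff-multiple 0 z≤n)) ⟩
    0S ⊕ (+ 1) • interval 0 p                       ≈⟨ (λ m → trans (ℤ.+-identityˡ _) (ℤ.*-identityˡ (interval 0 p m))) ⟩
    interval 0 p                                    ≡⟨ cong (interval 0) (sym p∸1+1) ⟩
    interval 0 (suc (p ∸ 1))                        ≈⟨ (λ m → pad (X^ 0 m) (interval 1 (p ∸ 1) m) (interval 1 p m)) ⟩
    rhs 0 0 (+ 0)                                   ∎
    where
    open ≈-Reasoning
    pad : ∀ x y z → x +ℤ y ≡ x +ℤ + 0 +ℤ y +ℤ + 0 *ℤ z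
    pad = solve-∀

  private
    +2≤⇒< : ∀ {i} → i + 2 ≤ p → i < p
    +2≤⇒< {i} = ℕ.<-≤-trans (ℕ.m<m+n i (s≤s z≤n))

    +2≤⇒<∸1 : ∀ {i} → i + 2 ≤ p → i < p ∸ 1
    +2≤⇒<∸1 {i} i+2≤p = ℕ.∸-monoˡ-≤ 1 (subst (_≤ p) (ℕ.+-comm i 2) i+2≤p)

    row-bound : ∀ i₁ {i₂} → i₁ + 2 ≤ p → i₂ < q → suc (row i₁ i₂) ≤ (p ∸ 1) * q
    row-bound i₁ {i₂} i₁+2≤p i₂<q = ℕ.≤-trans (ℕ.+-monoʳ-< (i₁ * q) i₂<q)
      (subst (_≤ (p ∸ 1) * q) (ℕ.+-comm q (i₁ * q)) (ℕ.*-monoˡ-≤ q (+2≤⇒<∸1 i₁+2≤p)))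

  partialProduct-row : ∀ i₁ i₂ i₃ → i₁ + 2 ≤ p → i₂ < q → i₃ < p →
    partialProduct (suc (row i₁ i₂ * p + i₃)) ≈S rhs i₁ (row i₁ i₂) (- 𝟙 (i₁ ℕ.<? i₃))
  partialProduct-rowStart : ∀ i₁ i₂ → i₁ + 2 ≤ p → i₂ < q →
    partialProduct (suc (row i₁ i₂ * p + 0)) ≈S rhs i₁ (row i₁ i₂) (+ 0)
  partialProduct-rowEnd : ∀ i₁ i₂ → i₁ + 2 ≤ p → i₂ < q →
    partialProduct (suc (row i₁ i₂ * p + (p ∸ 1))) ≈S rhs i₁ (row i₁ i₂) ℤ.-1ℤ

  partialProduct-row i₁ i₂ zero i₁+2≤p i₂<q _ = partialProduct-rowStart i₁ i₂ i₁+2≤p i₂<q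
  partialProduct-row i₁ i₂ (suc i₃) i₁+2≤p i₂<q i₃+1<p = partialProduct-step i₁ i₂<q i₃+1<p
    (partialProduct-row i₁ i₂ i₃ i₁+2≤p i₂<q (ℕ.<-trans (ℕ.n<1+n i₃) i₃+1<p))

  partialProduct-rowEnd i₁ i₂ i₁+2≤p i₂<q = ≈S-trans
    (partialProduct-row i₁ i₂ (p ∸ 1) i₁+2≤p i₂<q (subst (p ∸ 1 <_) p∸1+1 (ℕ.n<1+n (p ∸ 1))))
    (≈S-reflexive (cong (λ x → rhs i₁ (row i₁ i₂) (- x)) (𝟙-yes (i₁ ℕ.<? p ∸ 1) (+2≤⇒<∸1 i₁+2≤p))))

  partialProduct-rowStart zero zero _ _ = partialProduct-start
  partialProduct-rowStart i₁ (suc i₂) i₁+2≤p i₂+1<q =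
    subst (λ k → partialProduct (suc (k * p + 0)) ≈S rhs i₁ k (+ 0)) (sym (ℕ.+-suc (i₁ * q) i₂))
      (partialProduct-carry i₁ (row i₁ i₂) (+2≤⇒< i₁+2≤p) (row-bound i₁ i₁+2≤p i₂<q)
        (partialProduct-rowEnd i₁ i₂ i₁+2≤p i₂<q))
    where
    i₂<q : i₂ < q
    i₂<q = ℕ.<-trans (ℕ.n<1+n i₂) i₂+1<q
  partialProduct-rowStart (suc i₁) zero i₁+3≤p q>0 =
    subst (λ k → partialProduct (suc (k * p + 0)) ≈S rhs (suc i₁) k (+ 0)) k+1≡row (begin
      partialProduct (suc (suc k * p + 0))    ≈⟨ partialProduct-carry i₁ k (+2≤⇒< i₁+2≤p) bound
                                                   (partialProduct-rowEnd i₁ (q ∸ 1) i₁+2≤p q-1<q) ⟩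
      rhs i₁ (suc k) (+ 0)                    ≈⟨ rhs-next i₁ (suc k) (+2≤⇒<∸1 i₁+2≤p)
                                                   (trans (*-P (suc i₁)) (cong (λ x → x * p + suc i₁) [i₁+1]q≡k+1)) ⟩
      rhs (suc i₁) (suc k) (+ 0)              ∎)
    where
    open ≈-Reasoning
    i₁+2≤p : i₁ + 2 ≤ p
    i₁+2≤p = ℕ.≤-trans (ℕ.n≤1+n (i₁ + 2)) i₁+3≤p
    q-1+1 : suc (q ∸ 1) ≡ q
    q-1+1 = ℕ.suc-pred q {{ℕ.>-nonZero q>0}}
    q-1<q : q ∸ 1 < q
    q-1<q = subst (q ∸ 1 <_) q-1+1 (ℕ.n<1+n (q ∸ 1))
    k = row i₁ (q ∸ 1)
    [i₁+1]q≡k+1 : suc i₁ * q ≡ suc k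
    [i₁+1]q≡k+1 = trans (ℕ.+-comm q (i₁ * q)) (trans (cong (λ x → i₁ * q + x) (sym q-1+1)) (ℕ.+-suc (i₁ * q) (q ∸ 1)))
    k+1≡row : suc k ≡ row (suc i₁) 0
    k+1≡row = sym (trans (ℕ.+-identityʳ (suc i₁ * q)) [i₁+1]q≡k+1)
    bound : suc k ≤ (p ∸ 1) * q
    bound = subst (_≤ (p ∸ 1) * q) (sym k+1≡row) (ℕ.<⇒≤ (row-bound (suc i₁) i₁+3≤p q>0))

  statement-rhs≈rhs : ∀ i₁ i₂ i₃ →
    ΣS (upTo (suc i₁)) (λ a → X^ (a * P))
      ⊕ X^ (i₁ * P) ⊛ X^ (i₂ * p) ⊛ ΣS (map suc (upTo (p ∸ 1 ∸ i₁))) X^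
      ⊕ X^ (i₁ * P) ⊛ X^ (i₂ * p) ⊛ 𝒯 ((+ i₃ -ℤ + i₁) +ℤ + 1) (⊝ X^ 1) ⊛ ΣS (upTo p) X^
    ≈S rhs i₁ (row i₁ i₂) (- 𝟙 (i₁ ℕ.<? i₃))
  statement-rhs≈rhs i₁ i₂ i₃ = ⊕-cong (⊕-cong (≈S-refl {ΣS (upTo (suc i₁)) (λ a → X^ (a * P))}) tail-block) correction
    where
    open ≈-Reasoning
    L = p ∸ 1 ∸ i₁
    c = - 𝟙 (i₁ ℕ.<? i₃)
    blockStart : i₁ * P + i₂ * p + 1 ≡ row i₁ i₂ * p + suc i₁
    blockStart = solve i₁ i₂ q p
      where
      solve : ∀ i₁ i₂ q p → i₁ * suc (q * p) + i₂ * p + 1 ≡ (i₁ * q + i₂) * p + suc i₁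
      solve = ℕS.solve-∀
    tail-block : X^ (i₁ * P) ⊛ X^ (i₂ * p) ⊛ ΣS (map suc (upTo L)) X^ ≈S interval (row i₁ i₂ * p + suc i₁) L
    tail-block = begin
      X^ (i₁ * P) ⊛ X^ (i₂ * p) ⊛ ΣS (map suc (upTo L)) X^   ≈⟨ ⊛-cong (X^-⊛-X^ (i₁ * P) (i₂ * p))
                                                                  (≈S-trans (≈S-reflexive (cong (λ xs → ΣS xs X^) (map-upTo suc L)))
                                                                            (ΣS-X^-interval L 1 suc (λ _ → refl))) ⟩
      X^ (i₁ * P + i₂ * p) ⊛ interval 1 L                     ≈⟨ X^-⊛-interval (i₁ * P + i₂ * p) 1 L ⟩
      interval (i₁ * P + i₂ * p + 1) L                        ≡⟨ cong (λ a → interval a L) blockStart ⟩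
      interval (row i₁ i₂ * p + suc i₁) L                     ∎
    correction : X^ (i₁ * P) ⊛ X^ (i₂ * p) ⊛ 𝒯 ((+ i₃ -ℤ + i₁) +ℤ + 1) (⊝ X^ 1) ⊛ ΣS (upTo p) X^
                 ≈S c • interval (row i₁ i₂ * p + suc i₁) p
    correction = begin
      X^ (i₁ * P) ⊛ X^ (i₂ * p) ⊛ 𝒯 ((+ i₃ -ℤ + i₁) +ℤ + 1) (⊝ X^ 1) ⊛ repunit p
        ≈⟨ ⊛-congˡ (repunit p) (⊛-cong (X^-⊛-X^ (i₁ * P) (i₂ * p))
             (≈S-trans (𝒯-⊝X ((+ i₃ -ℤ + i₁) +ℤ + 1)) (•-congˡ (X^ 1) (cong -_ (𝟙-threshold i₁ i₃))))) ⟩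
      X^ (i₁ * P + i₂ * p) ⊛ (c • X^ 1) ⊛ repunit p
        ≈⟨ ⊛-congˡ (repunit p) (⊛-•-comm c (X^ (i₁ * P + i₂ * p)) (X^ 1)) ⟩
      (c • (X^ (i₁ * P + i₂ * p) ⊛ X^ 1)) ⊛ repunit p
        ≈⟨ •-⊛-assoc c (X^ (i₁ * P + i₂ * p) ⊛ X^ 1) (repunit p) ⟩
      c • ((X^ (i₁ * P + i₂ * p) ⊛ X^ 1) ⊛ repunit p)
        ≈⟨ •-congʳ c (≈S-trans (⊛-congˡ (repunit p) (X^-⊛-X^ (i₁ * P + i₂ * p) 1)) (X^-⊛-repunit (i₁ * P + i₂ * p + 1) p)) ⟩
      c • interval (i₁ * P + i₂ * p + 1) p
        ≡⟨ cong (λ a → c • interval a p) blockStart ⟩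
      c • interval (row i₁ i₂ * p + suc i₁) p
        ∎

lemma5 : (p₁ p₂ p₃ q₂ i₁ i₂ i₃ : ℕ) →
    Prime p₁ → Prime p₂ → Prime p₃ →
    ¬ (2 ∣ p₁) → ¬ (2 ∣ p₂) → ¬ (2 ∣ p₃) →
    p₁ < p₂ → p₂ < p₃ →
    p₂ ≡ suc (q₂ * p₁) →
    p₁ * p₂ ∣ p₃ ∸ 1 →
    i₁ + 2 ≤ p₁ → i₂ < q₂ → i₃ < p₁ →
    let u = i₁ * (p₂ ∸ 1) + i₂ * p₁ + i₃ in
    Φ p₁ ⊛ 𝒯 (+ suc u) (Φ (p₁ * p₂))
      ≈S ΣS (upTo (suc i₁)) (λ a → X^ (a * p₂))
         ⊕ X^ (i₁ * p₂) ⊛ X^ (i₂ * p₁) ⊛ ΣS (map suc (upTo (p₁ ∸ 1 ∸ i₁))) X^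
         ⊕ X^ (i₁ * p₂) ⊛ X^ (i₂ * p₁) ⊛ 𝒯 ((+ i₃ -ℤ + i₁) +ℤ + 1) (⊝ X^ 1) ⊛ ΣS (upTo p₁) X^
lemma5 p₁ .(suc (q₂ * p₁)) _ q₂ i₁ i₂ i₃ p₁-prime p₂-prime _ _ _ _ p₁<p₂ _ refl _ i₁+2≤p₁ i₂<q₂ i₃<p₁ = begin
  Φ p₁ ⊛ 𝒯 (+ suc u) (Φ (p₁ * p₂))                   ≈⟨ ⊛-congˡ (𝒯 (+ suc u) (Φ (p₁ * p₂))) (Φ-prime p₁-prime) ⟩
  partialProduct (suc u)                             ≡⟨ cong (partialProduct ∘ suc) u≡ ⟩
  partialProduct (suc (row i₁ i₂ * p₁ + i₃))         ≈⟨ partialProduct-row i₁ i₂ i₃ i₁+2≤p₁ i₂<q₂ i₃<p₁ ⟩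
  rhs i₁ (row i₁ i₂) (- 𝟙 (i₁ ℕ.<? i₃))              ≈⟨ statement-rhs≈rhs i₁ i₂ i₃ ⟨
  _                                                  ∎
  where
  open ≈-Reasoning
  open SemiprimeCyclotomic {q = q₂} p₁-prime p₂-prime p₁<p₂
  p₂ = suc (q₂ * p₁)
  u = i₁ * (q₂ * p₁) + i₂ * p₁ + i₃
  u≡ : u ≡ row i₁ i₂ * p₁ + i₃
  u≡ = solve i₁ i₂ i₃ q₂ p₁
    where
    solve : ∀ i₁ i₂ i₃ q p → i₁ * (q * p) + i₂ * p + i₃ ≡ (i₁ * q + i₂) * p + i₃
    solve = ℕS.solve-∀
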